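{- For any composition $\alpha\vDash n$ with $n>1$, \[L_{(1)}^\perp R_\alpha=\sum_{i:\ \alpha_i>1}R_{\alpha-\epsilon_i}+\sum_{j:\ \alpha^\top_j>1}R_{(\alpha^\top-\epsilon_j)^\top},\] where $\epsilon_i$ is the $i$-th standard basis vector (so $\alpha-\epsilon_i$ subtracts $1$ from the $i$-th part).
   Context: For a composition $\alpha=(\alpha_1,\dots,\alpha_\ell)\vDash n$, $\mathrm{Des}(\alpha)=\{\alpha_1,\alpha_1+\alpha_2,\dots,\alpha_1+\dots+\alpha_{\ell-1}\}$. $\alpha^c$ is the composition of $n$ with $\mathrm{Des}(\alpha^c)=[n-1]\setminus\mathrm{Des}(\alpha)$, and $\alpha^\top=\operatorname{rev}(\alpha^c)$ (parts in reverse order); equivalently, $\alpha^\top$ lists the column lengths of the ribbon diagram of $\alpha$ (the ribbon with row lengths $\alpha_1,\alpha_2,\dots$ from the bottom, each row's leftmost box directly above the previous row's rightmost box), i.e. its ribbon is the transpose. $\mathrm{QSym}$ is the ring of quasisymmetric functions with fundamental basis $L_\alpha=\sum x_{i_1}\cdots x_{i_n}$ over $i_1\le\dots\le i_n$ with $i_j<i_{j+1}$ for $j\in\mathrm{Des}(\alpha)$. $\mathrm{NSym}$ is its graded dual with ribbon basis $R_\alpha$ dual to $L_\alpha$ under $\langle R_\alpha,L_\gamma\rangle=\delta_{\alpha\gamma}$. For $F\in\mathrm{QSym}$, $F^\perp$ on $\mathrm{NSym}$ is defined by $\langle F^\perp H,G\rangle=\langle H,FG\rangle$ for all $G\in\mathrm{QSym}$.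 -}

module Defs where

open import Data.Nat using (ℕ; zero; suc; _+_; _∸_; _≤_; _<ᵇ_; _≡ᵇ_)
open import Data.Bool using (Bool; true; false; if_then_else_; _∧_; not)
open import Data.List using (List; []; _∷_; _++_; map; concatMap; replicate; length; reverse; upTo; foldr)
open import Data.Nat.ListAction using (sum)
import Data.List as List
open import Data.List.Relation.Unary.All using (All)
open import Data.Vec using (Vec; []; _∷_)
open import Data.Integer using (ℤ; +_) renaming (_+_ to _+ℤ_; _*_ to _*ℤ_)
open import Data.Product using (_×_)
open import Relation.Binary.PropositionalEquality using (_≡_)
import Data.List.Properties as LP
import Data.Nat as ℕ
open import Relation.Nullary.Decidable using (does)

IsComposition : ℕ → List ℕ → Set
IsComposition n α = All (λ a → 1 ≤ a) α × sum α ≡ n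

bumpHead : List (List ℕ) → List (List ℕ)
bumpHead [] = []
bumpHead ([] ∷ r) = bumpHead r
bumpHead ((a ∷ β) ∷ r) = (suc a ∷ β) ∷ bumpHead r

comps : ℕ → List (List ℕ)
comps zero = [] ∷ []
comps (suc n) = map (1 ∷_) (comps n) ++ bumpHead (comps n)

-- Des(α) = {α₁, α₁+α₂, …, α₁+…+α_{ℓ-1}}
des : List ℕ → List ℕ
des [] = []
des (a ∷ []) = []
des (a ∷ b ∷ r) = a ∷ map (λ x → a + x) (des (b ∷ r))

elemᵇ : ℕ → List ℕ → Bool
elemᵇ x [] = false
elemᵇ x (y ∷ ys) = if x ≡ᵇ y then true else elemᵇ x ys

gaps : List ℕ → List ℕ
gaps [] = []
gaps (x ∷ []) = []
gaps (x ∷ y ∷ r) = (y ∸ x) ∷ gaps (y ∷ r)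

range1 : ℕ → List ℕ
range1 n = map suc (upTo (n ∸ 1))

-- the composition of n whose descent set is D ∩ [n-1]
fromDes : ℕ → List ℕ → List ℕ
fromDes zero D = []
fromDes n@(suc _) D = gaps (0 ∷ (List.filterᵇ (λ d → elemᵇ d D) (range1 n) ++ (n ∷ [])))

complementC : List ℕ → List ℕ
complementC α = fromDes (sum α) (List.filterᵇ (λ d → not (elemᵇ d (des α))) (range1 (sum α)))

transposeC : List ℕ → List ℕ
transposeC α = reverse (complementC α)

minusEach : List ℕ → List (List ℕ)
minusEach [] = []
minusEach (a ∷ r) = (if 1 <ᵇ a then ((a ∸ 1) ∷ r) ∷ [] else []) ++ map (a ∷_) (minusEach r)

-- the right-hand side, as a formal sum (list with multiplicity) of ribbons R_β
rhs : List ℕ → List (List ℕ)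
rhs α = minusEach α ++ map transposeC (minusEach (transposeC α))

-- coefficient of R_γ in a formal sum of ribbons = ⟨ H , L_γ ⟩
ribbonCoeff : List (List ℕ) → List ℕ → ℤ
ribbonCoeff H γ = + countEq H
  where
  countEq : List (List ℕ) → ℕ
  countEq [] = 0
  countEq (β ∷ r) = if does (LP.≡-dec ℕ._≟_ γ β) then suc (countEq r) else countEq r

-- Quasisymmetric functions, restricted to N variables x₁ … x_N
-- (coefficient of the monomial with exponent vector e)

Series : Set
Series = (N : ℕ) → Vec ℕ N → ℤ

sumℤ : List ℤ → ℤ
sumℤ = foldr _+ℤ_ (+ 0)

below : ∀ {N} → Vec ℕ N → List (Vec ℕ N)
below [] = [] ∷ []
below (k ∷ e) = concatMap (λ i → map (i ∷_) (below e)) (upTo (suc k))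

_∸v_ : ∀ {N} → Vec ℕ N → Vec ℕ N → Vec ℕ N
[] ∸v [] = []
(a ∷ e) ∸v (b ∷ f) = (a ∸ b) ∷ (e ∸v f)

_⋆_ : Series → Series → Series
(F ⋆ G) N e = sumℤ (map (λ e₁ → F N e₁ *ℤ G N (e ∸v e₁)) (below e))

-- the weakly increasing word i₁ ≤ … ≤ iₙ of variable indices for monomial x^e
wordFrom : ∀ {N} → ℕ → Vec ℕ N → List ℕ
wordFrom i [] = []
wordFrom i (k ∷ e) = replicate k i ++ wordFrom (suc i) e

lookupD : List ℕ → ℕ → ℕ
lookupD [] _ = 0
lookupD (x ∷ _) zero = x
lookupD (_ ∷ xs) (suc k) = lookupD xs k

allᵇ : List ℕ → (ℕ → Bool) → Bool
allᵇ [] p = true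
allᵇ (x ∷ xs) p = p x ∧ allᵇ xs p

-- fundamental quasisymmetric function L_α:
-- sum of x_{i₁}⋯x_{iₙ}, i₁ ≤ … ≤ iₙ, with i_j < i_{j+1} for j ∈ Des(α)
L : List ℕ → Series
L α N e =
  let w = wordFrom 1 e in
  if (length w ≡ᵇ sum α) ∧ allᵇ (des α) (λ d → lookupD w (d ∸ 1) <ᵇ lookupD w d)
  then + 1 else + 0

IsLExpansion : ℕ → (List ℕ → ℤ) → Series → Set
IsLExpansion n c F = ∀ N (e : Vec ℕ N) → F N e ≡ sumℤ (map (λ β → c β *ℤ L β N e) (comps n))

-- A composition of n is encoded by its descent word t ∈ {false, true}ⁿ⁻¹ (fromBits t).  At the monomial
-- x^β whose exponent vector is β = fromBits s, L_(fromBits t) is the indicator of t ⊆ s, and multiplying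
-- by L_(1) deletes the first occurrence of a letter from the monomial's word; tracking ascents shows that
-- the values of L_(1) L_γ at these monomials are the subset sums of the multiset shuffleOne g (γ = fromBits g),
-- so by Möbius inversion c_α is the multiplicity of the descent word x of α in shuffleOne g.
-- That multiplicity is the number of ways to delete a false from x and obtain g, plus the number of ways
-- to delete a true.  In composition terms the former are the α − εᵢ, and the transposition symmetry
-- x ↦ reverse (map not x) of shuffleOne turns the latter into the (α^⊤ − εⱼ)^⊤.

module Submission where

open import Defs
open import Data.Product using (_,_)
open import Data.Bool using (Bool; true; false; not; _∧_; _∨_; if_then_else_)
open import Data.Bool.Properties using (not-involutive; ∧-zeroʳ; ∨-zeroʳ; ∧-identityʳ; T-≡) renaming (_≟_ to _≟𝔹_)
open import Data.Nat using (ℕ; zero; suc; _+_; _∸_; _≤_; _<_; z≤n; s≤s; _<ᵇ_; _≡ᵇ_)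
open import Data.Nat.Properties renaming (_≟_ to _≟ℕ_)
open import Data.Nat.ListAction using (sum)
open import Algebra.Properties.CommutativeSemigroup +-commutativeSemigroup using () renaming (x∙yz≈y∙xz to x+[y+z]≡y+[x+z])
open import Data.Nat.ListAction.Properties using (sum-++; sum-↭)
open import Data.List using (List; []; _∷_; _++_; map; concatMap; replicate; length; reverse; upTo; applyUpTo; filterᵇ; drop)
open import Data.List.Properties
  using (map-++; map-∘; map-cong; map-cong-local; map-id; map-upTo; reverse-map; reverse-++; reverse-involutive;
         unfold-reverse; length-reverse; length-map; length-drop; length-++; length-replicate; ≡-dec)
open import Data.List.Relation.Unary.All using (All; []; _∷_)
open import Data.List.Relation.Unary.Linked using (Linked; []; [-]; _∷_)
import Data.List.Relation.Unary.Linked as Linked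
import Data.List.Relation.Unary.All as All
import Data.List.Relation.Unary.All.Properties as All
open import Data.List.Relation.Unary.All.Properties using (++⁺)
open import Data.List.Relation.Binary.Permutation.Propositional.Properties using (↭-reverse)
open import Data.Vec using (Vec; []; _∷_)
import Data.Vec as Vec
open import Data.Integer using (ℤ; +_) renaming (_+_ to _+ℤ_; _*_ to _*ℤ_)
import Data.Integer.Properties as ℤ
open import Algebra.Properties.AbelianGroup ℤ.+-0-abelianGroup using () renaming (∙-cancelʳ to +ℤ-cancelʳ)
open import Algebra.Properties.CommutativeSemigroup ℤ.+-commutativeSemigroup using () renaming (interchange to +ℤ-interchange)
open import Function using (_∘_; id; mk⇔; Equivalence)
open import Function.Definitions using (Injective)
open import Relation.Binary.Definitions using (DecidableEquality)
open import Relation.Binary.PropositionalEquality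
open import Relation.Nullary.Decidable using (does; does-⇔; yes; no; dec-true; dec-false; T?)

𝟙 : Bool → ℕ
𝟙 false = 0
𝟙 true = 1

countᵇ : {A : Set} → (A → Bool) → List A → ℕ
countᵇ p xs = sum (map (𝟙 ∘ p) xs)

module _ {A : Set} (p : A → Bool) where

  countᵇ-++ : ∀ xs ys → countᵇ p (xs ++ ys) ≡ countᵇ p xs + countᵇ p ys
  countᵇ-++ xs ys = trans (cong sum (map-++ (𝟙 ∘ p) xs ys)) (sum-++ (map (𝟙 ∘ p) xs) _)

  countᵇ-reverse : ∀ xs → countᵇ p (reverse xs) ≡ countᵇ p xs
  countᵇ-reverse xs = trans (cong sum (reverse-map (𝟙 ∘ p) xs)) (sum-↭ (↭-reverse (map (𝟙 ∘ p) xs)))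

  countᵇ-map : ∀ {B : Set} (f : B → A) xs → countᵇ p (map f xs) ≡ countᵇ (p ∘ f) xs
  countᵇ-map f xs = cong sum (sym (map-∘ xs))

  countᵇ-cong : ∀ {q : A → Bool} → (∀ x → p x ≡ q x) → ∀ xs → countᵇ p xs ≡ countᵇ q xs
  countᵇ-cong p≗q xs = cong sum (map-cong (cong 𝟙 ∘ p≗q) xs)

  countᵇ-none : ∀ xs → All (λ x → p x ≡ false) xs → countᵇ p xs ≡ 0
  countᵇ-none [] [] = refl
  countᵇ-none (x ∷ xs) (px≡false ∷ pxs) rewrite px≡false = countᵇ-none xs pxs

  countᵇ-not+countᵇ : ∀ xs → countᵇ (not ∘ p) xs + countᵇ p xs ≡ length xs
  countᵇ-not+countᵇ [] = refl
  countᵇ-not+countᵇ (x ∷ xs) with p x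
  ... | true = trans (+-suc _ _) (cong suc (countᵇ-not+countᵇ xs))
  ... | false = cong suc (countᵇ-not+countᵇ xs)

_≟_ : DecidableEquality (List Bool)
_≟_ = ≡-dec _≟𝔹_

multiplicity : List Bool → List (List Bool) → ℕ
multiplicity u = countᵇ (λ v → does (u ≟ v))

multiplicity-map : ∀ {f : List Bool → List Bool} → Injective _≡_ _≡_ f →
                   ∀ u vs → multiplicity (f u) (map f vs) ≡ multiplicity u vs
multiplicity-map {f} f-inj u vs =
  trans (countᵇ-map _ f vs) (countᵇ-cong _ (λ v → does-⇔ (mk⇔ f-inj (cong f)) (f u ≟ f v) (u ≟ v)) vs)

sumℤ-++ : ∀ xs ys → sumℤ (xs ++ ys) ≡ sumℤ xs +ℤ sumℤ ys
sumℤ-++ [] ys = sym (ℤ.+-identityˡ (sumℤ ys))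
sumℤ-++ (x ∷ xs) ys = trans (cong (x +ℤ_) (sumℤ-++ xs ys)) (sym (ℤ.+-assoc x (sumℤ xs) (sumℤ ys)))

sumℤ-map-++ : ∀ {A : Set} (F : A → ℤ) xs ys → sumℤ (map F (xs ++ ys)) ≡ sumℤ (map F xs) +ℤ sumℤ (map F ys)
sumℤ-map-++ F xs ys = trans (cong sumℤ (map-++ F xs ys)) (sumℤ-++ (map F xs) (map F ys))

module _ {A : Set} where

  sumℤ-concatMap : ∀ {B : Set} (F : B → ℤ) (g : A → List B) xs →
                   sumℤ (map F (concatMap g xs)) ≡ sumℤ (map (λ x → sumℤ (map F (g x))) xs)
  sumℤ-concatMap F g [] = refl
  sumℤ-concatMap F g (x ∷ xs) =
    trans (sumℤ-map-++ F (g x) (concatMap g xs)) (cong (sumℤ (map F (g x)) +ℤ_) (sumℤ-concatMap F g xs))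

  sumℤ-zero : ∀ (F : A → ℤ) xs → All (λ x → F x ≡ + 0) xs → sumℤ (map F xs) ≡ + 0
  sumℤ-zero F [] [] = refl
  sumℤ-zero F (x ∷ xs) (Fx≡0 ∷ Fxs≡0) rewrite Fx≡0 | sumℤ-zero F xs Fxs≡0 = refl

  sumℤ-+ : ∀ (F G : A → ℤ) xs → sumℤ (map (λ x → F x +ℤ G x) xs) ≡ sumℤ (map F xs) +ℤ sumℤ (map G xs)
  sumℤ-+ F G [] = refl
  sumℤ-+ F G (x ∷ xs) = trans (cong (F x +ℤ G x +ℤ_) (sumℤ-+ F G xs)) (+ℤ-interchange (F x) (G x) _ _)

  sumℤ-𝟙 : ∀ (p : A → Bool) xs → sumℤ (map (λ x → + 𝟙 (p x)) xs) ≡ + countᵇ p xs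
  sumℤ-𝟙 p [] = refl
  sumℤ-𝟙 p (x ∷ xs) = trans (cong (+ 𝟙 (p x) +ℤ_) (sumℤ-𝟙 p xs)) (sym (ℤ.pos-+ (𝟙 (p x)) (countᵇ p xs)))

-- Möbius inversion on bit strings

bitStrings : ℕ → List (List Bool)
bitStrings zero = [] ∷ []
bitStrings (suc m) = map (true ∷_) (bitStrings m) ++ map (false ∷_) (bitStrings m)

length-bitStrings : ∀ m → All (λ t → length t ≡ m) (bitStrings m)
length-bitStrings zero = refl ∷ []
length-bitStrings (suc m) =
  ++⁺ (All.map⁺ {f = true ∷_} (All.map (cong suc) (length-bitStrings m)))
      (All.map⁺ {f = false ∷_} (All.map (cong suc) (length-bitStrings m)))

sumℤ-bitStrings : ∀ m (F : List Bool → ℤ) → sumℤ (map F (bitStrings (suc m))) ≡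
                  sumℤ (map (F ∘ (true ∷_)) (bitStrings m)) +ℤ sumℤ (map (F ∘ (false ∷_)) (bitStrings m))
sumℤ-bitStrings m F = trans (sumℤ-map-++ F (map (true ∷_) (bitStrings m)) _)
  (cong₂ _+ℤ_ (cong sumℤ (sym (map-∘ (bitStrings m)))) (cong sumℤ (sym (map-∘ (bitStrings m)))))

sumℤ-bitStrings-δ : ∀ m {u} → length u ≡ m → (F : List Bool → ℤ) →
                    sumℤ (map (λ t → + 𝟙 (does (t ≟ u)) *ℤ F t) (bitStrings m)) ≡ F u
sumℤ-bitStrings-δ zero {[]} refl F = trans (ℤ.+-identityʳ _) (ℤ.*-identityˡ (F []))
sumℤ-bitStrings-δ (suc m) {true ∷ u} |u|≡m F =
  trans (sumℤ-bitStrings m _)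
  (trans (cong₂ _+ℤ_ (sumℤ-bitStrings-δ m (suc-injective |u|≡m) (F ∘ (true ∷_)))
                     (sumℤ-zero _ (bitStrings m) (All.tabulate λ {t} _ → ℤ.*-zeroˡ (F (false ∷ t)))))
         (ℤ.+-identityʳ _))
sumℤ-bitStrings-δ (suc m) {false ∷ u} |u|≡m F =
  trans (sumℤ-bitStrings m _)
  (trans (cong₂ _+ℤ_ (sumℤ-zero _ (bitStrings m) (All.tabulate λ {t} _ → ℤ.*-zeroˡ (F (true ∷ t))))
                     (sumℤ-bitStrings-δ m (suc-injective |u|≡m) (F ∘ (false ∷_))))
         (ℤ.+-identityˡ _))

sumℤ-multiplicity : ∀ m {us} → All (λ u → length u ≡ m) us → (F : List Bool → ℤ) →
                    sumℤ (map (λ t → + multiplicity t us *ℤ F t) (bitStrings m)) ≡ sumℤ (map F us)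
sumℤ-multiplicity m [] F = sumℤ-zero _ (bitStrings m) (All.tabulate λ {t} _ → ℤ.*-zeroˡ (F t))
sumℤ-multiplicity m {u ∷ us} (|u|≡m ∷ |us|≡m) F = begin
  sumℤ (map (λ t → + (𝟙 (does (t ≟ u)) + multiplicity t us) *ℤ F t) (bitStrings m))
    ≡⟨ cong sumℤ (map-cong (λ t → trans (cong (_*ℤ F t) (ℤ.pos-+ (𝟙 (does (t ≟ u))) _))
                                        (ℤ.*-distribʳ-+ (F t) (+ 𝟙 (does (t ≟ u))) (+ multiplicity t us)))
                           (bitStrings m)) ⟩
  sumℤ (map (λ t → + 𝟙 (does (t ≟ u)) *ℤ F t +ℤ + multiplicity t us *ℤ F t) (bitStrings m))
    ≡⟨ sumℤ-+ _ _ (bitStrings m) ⟩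
  _ ≡⟨ cong₂ _+ℤ_ (sumℤ-bitStrings-δ m |u|≡m F) (sumℤ-multiplicity m |us|≡m F) ⟩
  F u +ℤ sumℤ (map F us) ∎
  where open ≡-Reasoning

infix 4 _⊆ᵇ_

_⊆ᵇ_ : List Bool → List Bool → Bool
[] ⊆ᵇ [] = true
(x ∷ xs) ⊆ᵇ (y ∷ ys) = (not x ∨ y) ∧ (xs ⊆ᵇ ys)
_ ⊆ᵇ _ = false

subsetSum : ℕ → (List Bool → ℤ) → List Bool → ℤ
subsetSum m f s = sumℤ (map (λ t → f t *ℤ + 𝟙 (t ⊆ᵇ s)) (bitStrings m))

subsetSum-false : ∀ m f s → subsetSum (suc m) f (false ∷ s) ≡ subsetSum m (f ∘ (false ∷_)) s
subsetSum-false m f s = begin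
  subsetSum (suc m) f (false ∷ s)
    ≡⟨ sumℤ-bitStrings m _ ⟩
  sumℤ (map (λ t → f (true ∷ t) *ℤ + 0) (bitStrings m)) +ℤ subsetSum m (f ∘ (false ∷_)) s
    ≡⟨ cong (_+ℤ subsetSum m (f ∘ (false ∷_)) s)
            (sumℤ-zero _ (bitStrings m) (All.tabulate λ {t} _ → ℤ.*-zeroʳ (f (true ∷ t)))) ⟩
  + 0 +ℤ subsetSum m (f ∘ (false ∷_)) s
    ≡⟨ ℤ.+-identityˡ _ ⟩
  subsetSum m (f ∘ (false ∷_)) s ∎
  where open ≡-Reasoning

subsetSum-true : ∀ m f s →
                 subsetSum (suc m) f (true ∷ s) ≡ subsetSum m (f ∘ (true ∷_)) s +ℤ subsetSum m (f ∘ (false ∷_)) s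
subsetSum-true m f s = sumℤ-bitStrings m _

subsetSum-injective : ∀ m {f g : List Bool → ℤ} →
                      (∀ s → length s ≡ m → subsetSum m f s ≡ subsetSum m g s) →
                      ∀ t → length t ≡ m → f t ≡ g t
subsetSum-injective zero {f} {g} f≈g [] _ = begin
  f []                       ≡⟨ sym (ℤ.*-identityʳ (f [])) ⟩
  f [] *ℤ + 1                ≡⟨ sym (ℤ.+-identityʳ _) ⟩
  subsetSum zero f []        ≡⟨ f≈g [] refl ⟩
  subsetSum zero g []        ≡⟨ ℤ.+-identityʳ _ ⟩
  g [] *ℤ + 1                ≡⟨ ℤ.*-identityʳ (g []) ⟩
  g []                       ∎
  where open ≡-Reasoning
subsetSum-injective (suc m) {f} {g} f≈g (b ∷ t) |t|≡m = bit b t (suc-injective |t|≡m)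
  where
  false-half : ∀ s → length s ≡ m → subsetSum m (f ∘ (false ∷_)) s ≡ subsetSum m (g ∘ (false ∷_)) s
  false-half s |s|≡m = begin
    subsetSum m (f ∘ (false ∷_)) s      ≡⟨ sym (subsetSum-false m f s) ⟩
    subsetSum (suc m) f (false ∷ s)     ≡⟨ f≈g (false ∷ s) (cong suc |s|≡m) ⟩
    subsetSum (suc m) g (false ∷ s)     ≡⟨ subsetSum-false m g s ⟩
    subsetSum m (g ∘ (false ∷_)) s      ∎
    where open ≡-Reasoning
  true-half : ∀ s → length s ≡ m → subsetSum m (f ∘ (true ∷_)) s ≡ subsetSum m (g ∘ (true ∷_)) s
  true-half s |s|≡m = +ℤ-cancelʳ (subsetSum m (f ∘ (false ∷_)) s) _ _ (begin
    subsetSum m (f ∘ (true ∷_)) s +ℤ subsetSum m (f ∘ (false ∷_)) s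
      ≡⟨ sym (subsetSum-true m f s) ⟩
    subsetSum (suc m) f (true ∷ s)
      ≡⟨ f≈g (true ∷ s) (cong suc |s|≡m) ⟩
    subsetSum (suc m) g (true ∷ s)
      ≡⟨ subsetSum-true m g s ⟩
    subsetSum m (g ∘ (true ∷_)) s +ℤ subsetSum m (g ∘ (false ∷_)) s
      ≡⟨ cong (subsetSum m (g ∘ (true ∷_)) s +ℤ_) (sym (false-half s |s|≡m)) ⟩
    subsetSum m (g ∘ (true ∷_)) s +ℤ subsetSum m (f ∘ (false ∷_)) s ∎)
    where open ≡-Reasoning
  bit : ∀ b t → length t ≡ m → f (b ∷ t) ≡ g (b ∷ t)
  bit true = subsetSum-injective m true-half
  bit false = subsetSum-injective m false-half

-- Compositions as descent words

leadingFalses : List Bool → ℕ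
leadingFalses (false ∷ t) = suc (leadingFalses t)
leadingFalses _ = 0

-- fromBits t is the composition of length t + 1 whose descent set is {i | the i-th bit of t is true}.
fromBits : List Bool → List ℕ
laterParts : List Bool → List ℕ

fromBits t = suc (leadingFalses t) ∷ laterParts t

laterParts [] = []
laterParts (true ∷ t) = fromBits t
laterParts (false ∷ t) = laterParts t

toBits : List ℕ → List Bool
toBits [] = []
toBits (a ∷ []) = replicate (a ∸ 1) false
toBits (a ∷ b ∷ α) = replicate (a ∸ 1) false ++ true ∷ toBits (b ∷ α)

incrementHead : List ℕ → List ℕ
incrementHead [] = []
incrementHead (a ∷ α) = suc a ∷ α

fromBits-falses-true : ∀ k t → fromBits (replicate k false ++ true ∷ t) ≡ suc k ∷ fromBits t
fromBits-falses-true zero t = refl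
fromBits-falses-true (suc k) t = cong incrementHead (fromBits-falses-true k t)

fromBits-falses : ∀ k → fromBits (replicate k false) ≡ suc k ∷ []
fromBits-falses zero = refl
fromBits-falses (suc k) = cong incrementHead (fromBits-falses k)

fromBits-toBits : ∀ {a} α → All (1 ≤_) (a ∷ α) → fromBits (toBits (a ∷ α)) ≡ a ∷ α
fromBits-toBits {suc a} [] (s≤s z≤n ∷ _) = fromBits-falses a
fromBits-toBits {suc a} (b ∷ α) (s≤s z≤n ∷ α⁺) =
  trans (fromBits-falses-true a (toBits (b ∷ α))) (cong (suc a ∷_) (fromBits-toBits α α⁺))

toBits-incrementHead : ∀ a α → toBits (suc (suc a) ∷ α) ≡ false ∷ toBits (suc a ∷ α)
toBits-incrementHead a [] = refl
toBits-incrementHead a (_ ∷ _) = refl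

toBits-fromBits : ∀ t → toBits (fromBits t) ≡ t
toBits-fromBits [] = refl
toBits-fromBits (true ∷ t) = cong (true ∷_) (toBits-fromBits t)
toBits-fromBits (false ∷ t) =
  trans (toBits-incrementHead (leadingFalses t) (laterParts t)) (cong (false ∷_) (toBits-fromBits t))

fromBits-injective : Injective _≡_ _≡_ fromBits
fromBits-injective {t} {u} eq = trans (sym (toBits-fromBits t)) (trans (cong toBits eq) (toBits-fromBits u))

fromBits-positive : ∀ t → All (1 ≤_) (fromBits t)
laterParts-positive : ∀ t → All (1 ≤_) (laterParts t)
fromBits-positive t = s≤s z≤n ∷ laterParts-positive t
laterParts-positive [] = []
laterParts-positive (true ∷ t) = fromBits-positive t
laterParts-positive (false ∷ t) = laterParts-positive t

sum-fromBits : ∀ t → sum (fromBits t) ≡ suc (length t)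
sum-fromBits [] = refl
sum-fromBits (true ∷ t) = cong suc (sum-fromBits t)
sum-fromBits (false ∷ t) = cong suc (sum-fromBits t)

fromBits-toBits-composition : ∀ {n} α → IsComposition (suc n) α → fromBits (toBits α) ≡ α
fromBits-toBits-composition (a ∷ α) (α⁺ , _) = fromBits-toBits α α⁺

length-toBits : ∀ {n} α → IsComposition (suc n) α → length (toBits α) ≡ n
length-toBits {n} α α-comp@(_ , Σα≡1+n) = suc-injective (begin
  suc (length (toBits α))    ≡⟨ sym (sum-fromBits (toBits α)) ⟩
  sum (fromBits (toBits α))  ≡⟨ cong sum (fromBits-toBits-composition α α-comp) ⟩
  sum α                      ≡⟨ Σα≡1+n ⟩
  suc n                      ∎)
  where open ≡-Reasoning

comps-bitStrings : ∀ m → comps (suc m) ≡ map fromBits (bitStrings m)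
comps-bitStrings zero = refl
comps-bitStrings (suc m) rewrite comps-bitStrings m = sym (begin
  map fromBits (map (true ∷_) (bitStrings m) ++ map (false ∷_) (bitStrings m))
    ≡⟨ map-++ fromBits (map (true ∷_) (bitStrings m)) _ ⟩
  map fromBits (map (true ∷_) (bitStrings m)) ++ map fromBits (map (false ∷_) (bitStrings m))
    ≡⟨ cong₂ _++_ (trans (sym (map-∘ (bitStrings m))) (map-∘ (bitStrings m)))
                  (trans (sym (map-∘ (bitStrings m))) (sym (bumpHead-map (bitStrings m)))) ⟩
  map (1 ∷_) (map fromBits (bitStrings m)) ++ bumpHead (map fromBits (bitStrings m)) ∎)
  where
  open ≡-Reasoning
  bumpHead-map : ∀ ts → bumpHead (map fromBits ts) ≡ map (fromBits ∘ (false ∷_)) ts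
  bumpHead-map [] = refl
  bumpHead-map (t ∷ ts) = cong (fromBits (false ∷ t) ∷_) (bumpHead-map ts)

interval : ℕ → ℕ → List ℕ
interval s zero = []
interval s (suc m) = suc s ∷ interval (suc s) m

range1-interval : ∀ m → range1 (suc m) ≡ interval 0 m
range1-interval m = trans (map-upTo suc m) (applyUpTo-interval 0 m (λ _ → refl))
  where
  applyUpTo-interval : ∀ {f : ℕ → ℕ} s m → (∀ i → f i ≡ suc (s + i)) → applyUpTo f m ≡ interval s m
  applyUpTo-interval s zero _ = refl
  applyUpTo-interval s (suc m) f≗ = cong₂ _∷_ (trans (f≗ 0) (cong suc (+-identityʳ s)))
    (applyUpTo-interval (suc s) m (λ i → trans (f≗ (suc i)) (cong suc (+-suc s i))))

interval-> : ∀ s m → All (s <_) (interval s m)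
interval-> s zero = []
interval-> s (suc m) = ≤-refl ∷ All.map (<-trans (n<1+n s)) (interval-> (suc s) m)

map-suc-interval : ∀ s m → map suc (interval s m) ≡ interval (suc s) m
map-suc-interval s zero = refl
map-suc-interval s (suc m) = cong (suc (suc s) ∷_) (map-suc-interval (suc s) m)

∸-suc : ∀ {s y} → suc s < y → y ∸ s ≡ suc (y ∸ suc s)
∸-suc (s≤s s<y) = +-∸-assoc 1 (<⇒≤ s<y)

gaps-incrementHead : ∀ s L e → All (suc s <_) L → suc s < e →
                     gaps (s ∷ L ++ e ∷ []) ≡ incrementHead (gaps (suc s ∷ L ++ e ∷ []))
gaps-incrementHead s [] e _ s<e = cong (_∷ []) (∸-suc s<e)
gaps-incrementHead s (y ∷ L) e (s<y ∷ _) _ = cong (_∷ gaps (y ∷ L ++ e ∷ [])) (∸-suc s<y)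

gaps-interval : ∀ (p : ℕ → Bool) s m →
                gaps (s ∷ filterᵇ p (interval s m) ++ suc (s + m) ∷ []) ≡ fromBits (map p (interval s m))
gaps-interval p s zero = cong (_∷ []) (trans (cong (_∸ s) (sym (+-suc s 0))) (m+n∸m≡n s 1))
gaps-interval p s (suc m) rewrite +-suc s m with p (suc s)
... | true = cong₂ _∷_ (m+n∸n≡m 1 s) (gaps-interval p (suc s) m)
... | false = trans (gaps-incrementHead s _ _ (All.filter⁺ (T? ∘ p) (interval-> (suc s) m)) (s≤s (s≤s (m≤m+n s m))))
                    (cong incrementHead (gaps-interval p (suc s) m))

fromDes-interval : ∀ m D → fromDes (suc m) D ≡ fromBits (map (λ d → elemᵇ d D) (interval 0 m))
fromDes-interval m D = trans (cong (λ I → gaps (0 ∷ filterᵇ (λ d → elemᵇ d D) I ++ suc m ∷ [])) (range1-interval m))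
                             (gaps-interval (λ d → elemᵇ d D) 0 m)

elemᵇ-map-suc : ∀ d D → elemᵇ (suc d) (map suc D) ≡ elemᵇ d D
elemᵇ-map-suc d [] = refl
elemᵇ-map-suc d (y ∷ D) = cong (if d ≡ᵇ y then true else_) (elemᵇ-map-suc d D)

elemᵇ-zero-map-suc : ∀ D → elemᵇ 0 (map suc D) ≡ false
elemᵇ-zero-map-suc [] = refl
elemᵇ-zero-map-suc (y ∷ D) = elemᵇ-zero-map-suc D

≡ᵇ-refl : ∀ n → (n ≡ᵇ n) ≡ true
≡ᵇ-refl n = dec-true (n ≟ℕ n) refl

≡ᵇ-true⇒≡ : ∀ {m n} → (m ≡ᵇ n) ≡ true → m ≡ n
≡ᵇ-true⇒≡ {m} {n} m≡ᵇn = ≡ᵇ⇒≡ m n (Equivalence.from T-≡ m≡ᵇn)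

elemᵇ-self : ∀ xs → All (λ d → elemᵇ d xs ≡ true) xs
elemᵇ-self [] = []
elemᵇ-self (y ∷ ys) = here ∷ All.map there (elemᵇ-self ys)
  where
  here : elemᵇ y (y ∷ ys) ≡ true
  here rewrite ≡ᵇ-refl y = refl
  there : ∀ {d} → elemᵇ d ys ≡ true → elemᵇ d (y ∷ ys) ≡ true
  there {d} d∈ys with d ≡ᵇ y
  ... | true = refl
  ... | false = d∈ys

elemᵇ-filterᵇ : ∀ d (p : ℕ → Bool) xs → elemᵇ d (filterᵇ p xs) ≡ elemᵇ d xs ∧ p d
elemᵇ-filterᵇ d p [] = refl
elemᵇ-filterᵇ d p (y ∷ ys) with p y in py
... | true with d ≡ᵇ y in d≡y
...   | true = sym (trans (cong p (≡ᵇ-true⇒≡ d≡y)) py)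
...   | false = elemᵇ-filterᵇ d p ys
elemᵇ-filterᵇ d p (y ∷ ys) | false with d ≡ᵇ y in d≡y
...   | true = let pd≡false = trans (cong p (≡ᵇ-true⇒≡ d≡y)) py in
    trans (elemᵇ-filterᵇ d p ys) (trans (cong (elemᵇ d ys ∧_) pd≡false) (trans (∧-zeroʳ _) (sym pd≡false)))
...   | false = elemᵇ-filterᵇ d p ys

des-fromBits-false : ∀ t → des (fromBits (false ∷ t)) ≡ map suc (des (fromBits t))
des-fromBits-false t = shift (leadingFalses t) (laterParts t)
  where
  shift : ∀ a α → des (suc (suc a) ∷ α) ≡ map suc (des (suc a ∷ α))
  shift a [] = refl
  shift a (b ∷ α) = cong (suc (suc a) ∷_) (map-∘ (des (b ∷ α)))

zero∉des-fromBits : ∀ t → elemᵇ 0 (des (fromBits t)) ≡ false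
zero∉des-fromBits [] = refl
zero∉des-fromBits (true ∷ t) = elemᵇ-zero-map-suc (des (fromBits t))
zero∉des-fromBits (false ∷ t) rewrite des-fromBits-false t = elemᵇ-zero-map-suc (des (fromBits t))

descentBits-fromBits : ∀ t → map (λ d → elemᵇ d (des (fromBits t))) (interval 0 (length t)) ≡ t
descentBits-fromBits [] = refl
descentBits-fromBits (true ∷ t) rewrite sym (map-suc-interval 0 (length t)) = cong (true ∷_) (begin
  map (λ d → elemᵇ d (1 ∷ map suc D)) (map suc I)  ≡⟨ sym (map-∘ I) ⟩
  map (λ d → elemᵇ (suc d) (1 ∷ map suc D)) I
    ≡⟨ map-cong-local (All.map (λ { {suc d} _ → elemᵇ-map-suc (suc d) D }) (interval-> 0 (length t))) ⟩
  map (λ d → elemᵇ d D) I                         ≡⟨ descentBits-fromBits t ⟩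
  t ∎)
  where
  open ≡-Reasoning
  D = des (fromBits t)
  I = interval 0 (length t)
descentBits-fromBits (false ∷ t) rewrite des-fromBits-false t | sym (map-suc-interval 0 (length t)) =
  cong₂ _∷_ (trans (elemᵇ-map-suc 0 D) (zero∉des-fromBits t)) (begin
  map (λ d → elemᵇ d (map suc D)) (map suc I)  ≡⟨ sym (map-∘ I) ⟩
  map (λ d → elemᵇ (suc d) (map suc D)) I     ≡⟨ map-cong (λ d → elemᵇ-map-suc d D) I ⟩
  map (λ d → elemᵇ d D) I                     ≡⟨ descentBits-fromBits t ⟩
  t ∎)
  where
  open ≡-Reasoning
  D = des (fromBits t)
  I = interval 0 (length t)

complementC-fromBits : ∀ t → complementC (fromBits t) ≡ fromBits (map not t)
complementC-fromBits t = begin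
  complementC (fromBits t)
    ≡⟨ cong (λ n → fromDes n (filterᵇ notDes (range1 n))) (sum-fromBits t) ⟩
  fromDes (suc (length t)) (filterᵇ notDes (range1 (suc (length t))))
    ≡⟨ cong (λ R → fromDes (suc (length t)) (filterᵇ notDes R)) (range1-interval (length t)) ⟩
  fromDes (suc (length t)) (filterᵇ notDes I)
    ≡⟨ fromDes-interval (length t) (filterᵇ notDes I) ⟩
  fromBits (map (λ d → elemᵇ d (filterᵇ notDes I)) I)
    ≡⟨ cong fromBits (map-cong-local (All.map (λ {d} d∈I → trans (elemᵇ-filterᵇ d notDes I) (cong (_∧ notDes d) d∈I))
                                              (elemᵇ-self I))) ⟩
  fromBits (map notDes I)
    ≡⟨ cong fromBits (trans (map-∘ I) (cong (map not) (descentBits-fromBits t))) ⟩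
  fromBits (map not t) ∎
  where
  open ≡-Reasoning
  I = interval 0 (length t)
  notDes : ℕ → Bool
  notDes d = not (elemᵇ d (des (fromBits t)))

incrementLast : List ℕ → List ℕ
incrementLast [] = []
incrementLast (a ∷ []) = suc a ∷ []
incrementLast (a ∷ b ∷ α) = a ∷ incrementLast (b ∷ α)

incrementLast-∷ʳ : ∀ α a → incrementLast (α ++ a ∷ []) ≡ α ++ suc a ∷ []
incrementLast-∷ʳ [] a = refl
incrementLast-∷ʳ (b ∷ []) a = refl
incrementLast-∷ʳ (b ∷ c ∷ α) a = cong (b ∷_) (incrementLast-∷ʳ (c ∷ α) a)

fromBits-∷ʳ-true : ∀ t → fromBits (t ++ true ∷ []) ≡ fromBits t ++ 1 ∷ []
fromBits-∷ʳ-true [] = refl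
fromBits-∷ʳ-true (true ∷ t) = cong (1 ∷_) (fromBits-∷ʳ-true t)
fromBits-∷ʳ-true (false ∷ t) = cong incrementHead (fromBits-∷ʳ-true t)

fromBits-∷ʳ-false : ∀ t → fromBits (t ++ false ∷ []) ≡ incrementLast (fromBits t)
fromBits-∷ʳ-false [] = refl
fromBits-∷ʳ-false (true ∷ t) = cong (1 ∷_) (fromBits-∷ʳ-false t)
fromBits-∷ʳ-false (false ∷ t) =
  trans (cong incrementHead (fromBits-∷ʳ-false t)) (commute (suc (leadingFalses t)) (laterParts t))
  where
  commute : ∀ a α → incrementHead (incrementLast (a ∷ α)) ≡ incrementLast (suc a ∷ α)
  commute a [] = refl
  commute a (_ ∷ _) = refl

reverse-fromBits : ∀ t → reverse (fromBits t) ≡ fromBits (reverse t)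
reverse-fromBits [] = refl
reverse-fromBits (true ∷ t) = begin
  reverse (1 ∷ fromBits t)             ≡⟨ unfold-reverse 1 (fromBits t) ⟩
  reverse (fromBits t) ++ 1 ∷ []       ≡⟨ cong (_++ 1 ∷ []) (reverse-fromBits t) ⟩
  fromBits (reverse t) ++ 1 ∷ []       ≡⟨ sym (fromBits-∷ʳ-true (reverse t)) ⟩
  fromBits (reverse t ++ true ∷ [])    ≡⟨ cong fromBits (sym (unfold-reverse true t)) ⟩
  fromBits (reverse (true ∷ t))        ∎
  where open ≡-Reasoning
reverse-fromBits (false ∷ t) = begin
  reverse (suc a ∷ α)                  ≡⟨ unfold-reverse (suc a) α ⟩
  reverse α ++ suc a ∷ []              ≡⟨ sym (incrementLast-∷ʳ (reverse α) a) ⟩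
  incrementLast (reverse α ++ a ∷ [])  ≡⟨ cong incrementLast (sym (unfold-reverse a α)) ⟩
  incrementLast (reverse (fromBits t)) ≡⟨ cong incrementLast (reverse-fromBits t) ⟩
  incrementLast (fromBits (reverse t)) ≡⟨ sym (fromBits-∷ʳ-false (reverse t)) ⟩
  fromBits (reverse t ++ false ∷ [])   ≡⟨ cong fromBits (sym (unfold-reverse false t)) ⟩
  fromBits (reverse (false ∷ t))       ∎
  where
  open ≡-Reasoning
  a = suc (leadingFalses t)
  α = laterParts t

transposeBits : List Bool → List Bool
transposeBits t = reverse (map not t)

transposeC-fromBits : ∀ t → transposeC (fromBits t) ≡ fromBits (transposeBits t)
transposeC-fromBits t = trans (cong reverse (complementC-fromBits t)) (reverse-fromBits (map not t))

-- deleteFalse p t deletes from t the first bit of a maximal run of falses, p being the bit before t;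
-- deleteTrue p t does the same for runs of trues, p being the negated bit before t.  Started at true,
-- they list every word obtained by deleting one false (resp. true) exactly once.
deleteFalse : Bool → List Bool → List (List Bool)
deleteFalse p [] = []
deleteFalse p (x ∷ t) = (if not x ∧ p then t ∷ [] else []) ++ map (x ∷_) (deleteFalse x t)

deleteTrue : Bool → List Bool → List (List Bool)
deleteTrue p [] = []
deleteTrue p (x ∷ t) = (if x ∧ p then t ∷ [] else []) ++ map (x ∷_) (deleteTrue (not x) t)

minusEach-fromBits : ∀ t → minusEach (fromBits t) ≡ map fromBits (deleteFalse true t)
minusEach-laterParts : ∀ t → map (suc (leadingFalses t) ∷_) (minusEach (laterParts t)) ≡ map fromBits (deleteFalse false t)
minusEach-true∷ : ∀ t → map (1 ∷_) (minusEach (fromBits t)) ≡ map fromBits (map (true ∷_) (deleteFalse true t))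
minusEach-false∷ : ∀ t → map (suc (suc (leadingFalses t)) ∷_) (minusEach (laterParts t)) ≡
                         map fromBits (map (false ∷_) (deleteFalse false t))

minusEach-fromBits [] = refl
minusEach-fromBits (true ∷ t) = minusEach-true∷ t
minusEach-fromBits (false ∷ t) = cong (fromBits t ∷_) (minusEach-false∷ t)

minusEach-laterParts [] = refl
minusEach-laterParts (true ∷ t) = minusEach-true∷ t
minusEach-laterParts (false ∷ t) = minusEach-false∷ t

minusEach-true∷ t = begin
  map (1 ∷_) (minusEach (fromBits t))                 ≡⟨ cong (map (1 ∷_)) (minusEach-fromBits t) ⟩
  map (1 ∷_) (map fromBits (deleteFalse true t))      ≡⟨ trans (sym (map-∘ _)) (map-∘ _) ⟩
  map fromBits (map (true ∷_) (deleteFalse true t))   ∎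
  where open ≡-Reasoning

minusEach-false∷ t = begin
  map (suc a ∷_) (minusEach α)                           ≡⟨ map-∘ (minusEach α) ⟩
  map incrementHead (map (a ∷_) (minusEach α))           ≡⟨ cong (map incrementHead) (minusEach-laterParts t) ⟩
  map incrementHead (map fromBits (deleteFalse false t)) ≡⟨ trans (sym (map-∘ _)) (map-∘ _) ⟩
  map fromBits (map (false ∷_) (deleteFalse false t))    ∎
  where
  open ≡-Reasoning
  a = suc (leadingFalses t)
  α = laterParts t

rhs-fromBits : ∀ x → rhs (fromBits x) ≡ map fromBits (deleteFalse true x ++ map transposeBits (deleteFalse true (transposeBits x)))
rhs-fromBits x = begin
  minusEach (fromBits x) ++ map transposeC (minusEach (transposeC (fromBits x)))
    ≡⟨ cong₂ (λ M N → M ++ map transposeC N) (minusEach-fromBits x)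
             (trans (cong minusEach (transposeC-fromBits x)) (minusEach-fromBits (transposeBits x))) ⟩
  map fromBits Dx ++ map transposeC (map fromBits Dxᵀ)
    ≡⟨ cong (map fromBits Dx ++_) (trans (sym (map-∘ Dxᵀ)) (trans (map-cong transposeC-fromBits Dxᵀ) (map-∘ Dxᵀ))) ⟩
  map fromBits Dx ++ map fromBits (map transposeBits Dxᵀ)
    ≡⟨ sym (map-++ fromBits Dx _) ⟩
  map fromBits (Dx ++ map transposeBits Dxᵀ) ∎
  where
  open ≡-Reasoning
  Dx = deleteFalse true x
  Dxᵀ = deleteFalse true (transposeBits x)

ribbonCoeff-fromBits : ∀ H g → ribbonCoeff (map fromBits H) (fromBits g) ≡ + multiplicity g H
ribbonCoeff-fromBits [] g = refl
ribbonCoeff-fromBits (t ∷ H) g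
  rewrite does-⇔ (mk⇔ fromBits-injective (cong fromBits)) (≡-dec _≟ℕ_ (fromBits g) (fromBits t)) (g ≟ t)
  with does (g ≟ t) | ℤ.+-injective (ribbonCoeff-fromBits H g)
... | true | IH = cong (+_ ∘ suc) IH
... | false | IH = cong +_ IH

-- The shuffle identity

multiplicity-∷-map : ∀ b c u L → multiplicity (b ∷ u) (map (c ∷_) L) ≡ (if does (b ≟𝔹 c) then multiplicity u L else 0)
multiplicity-∷-map true true u L = countᵇ-map _ (true ∷_) L
multiplicity-∷-map false false u L = countᵇ-map _ (false ∷_) L
multiplicity-∷-map true false u L = trans (countᵇ-map _ (false ∷_) L) (countᵇ-none _ L (All.tabulate (λ _ → refl)))
multiplicity-∷-map false true u L = trans (countᵇ-map _ (true ∷_) L) (countᵇ-none _ L (All.tabulate (λ _ → refl)))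

insertTrue : List Bool → List (List Bool)
insertTrue [] = (true ∷ []) ∷ []
insertTrue (b ∷ v) = (true ∷ false ∷ v) ∷ map (b ∷_) (insertTrue v)

-- The descent words of the compositions in the L-expansion of L_(1) L_(fromBits g).
shuffleOne : List Bool → List (List Bool)
shuffleOne g = (false ∷ g) ∷ insertTrue g

≟-sym : ∀ u v → does (u ≟ v) ≡ does (v ≟ u)
≟-sym u v = does-⇔ (mk⇔ sym sym) (u ≟ v) (v ≟ u)

-- The deletions of a false and of a true from c ∷ x, split by whether c itself is deleted.
multiplicity-insertTrue : ∀ g x c → length x ≡ length g →
  multiplicity (c ∷ x) (insertTrue g) ≡
  (if c then 𝟙 (does (g ≟ x)) else 0) + (multiplicity g (map (c ∷_) (deleteFalse c x)) + multiplicity g (map (c ∷_) (deleteTrue (not c) x)))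
multiplicity-insertTrue [] [] true _ = refl
multiplicity-insertTrue [] [] false _ = refl
multiplicity-insertTrue (b ∷ v) (d ∷ x) c |x|≡|g| = step b c d
  where
  IH : ∀ d → multiplicity (d ∷ x) (insertTrue v) ≡
       (if d then 𝟙 (does (v ≟ x)) else 0) + (multiplicity v (map (d ∷_) (deleteFalse d x)) + multiplicity v (map (d ∷_) (deleteTrue (not d) x)))
  IH d = multiplicity-insertTrue v x d (suc-injective |x|≡|g|)
  step : ∀ b c d → multiplicity (c ∷ d ∷ x) (insertTrue (b ∷ v)) ≡
         (if c then 𝟙 (does ((b ∷ v) ≟ (d ∷ x))) else 0) +
         (multiplicity (b ∷ v) (map (c ∷_) (deleteFalse c (d ∷ x))) + multiplicity (b ∷ v) (map (c ∷_) (deleteTrue (not c) (d ∷ x))))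
  step true true true
    rewrite multiplicity-∷-map true true (true ∷ x) (insertTrue v) | IH true
          | multiplicity-∷-map true true v (map (true ∷_) (deleteFalse true x))
          | multiplicity-∷-map true true v (map (true ∷_) (deleteTrue false x)) = refl
  step true true false
    rewrite multiplicity-∷-map true true (false ∷ x) (insertTrue v) | IH false
          | multiplicity-∷-map true true v (map (false ∷_) (deleteFalse false x))
          | multiplicity-∷-map true true v (map (false ∷_) (deleteTrue true x)) | ≟-sym x v =
    sym (+-assoc (𝟙 (does (v ≟ x))) _ _)
  step true false true
    rewrite multiplicity-∷-map false true (true ∷ x) (insertTrue v)
          | multiplicity-∷-map true false v (map (true ∷_) (deleteFalse true x))
          | multiplicity-∷-map true false v (map (true ∷_) (deleteTrue false x)) = refl
  step true false false
    rewrite multiplicity-∷-map false true (false ∷ x) (insertTrue v)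
          | multiplicity-∷-map true false v (map (false ∷_) (deleteFalse false x))
          | multiplicity-∷-map true false v (map (false ∷_) (deleteTrue true x)) = refl
  step false true true
    rewrite multiplicity-∷-map true false (true ∷ x) (insertTrue v)
          | multiplicity-∷-map false true v (map (true ∷_) (deleteFalse true x))
          | multiplicity-∷-map false true v (map (true ∷_) (deleteTrue false x)) = refl
  step false true false
    rewrite multiplicity-∷-map true false (false ∷ x) (insertTrue v)
          | multiplicity-∷-map false true v (map (false ∷_) (deleteFalse false x))
          | multiplicity-∷-map false true v (map (false ∷_) (deleteTrue true x)) | ≟-sym x v = refl
  step false false true
    rewrite multiplicity-∷-map false false (true ∷ x) (insertTrue v) | IH true
          | multiplicity-∷-map false false v (map (true ∷_) (deleteFalse true x))
          | multiplicity-∷-map false false v (map (true ∷_) (deleteTrue false x)) =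
    x+[y+z]≡y+[x+z] (𝟙 (does (v ≟ x))) (multiplicity v (map (true ∷_) (deleteFalse true x))) _
  step false false false
    rewrite multiplicity-∷-map false false (false ∷ x) (insertTrue v) | IH false
          | multiplicity-∷-map false false v (map (false ∷_) (deleteFalse false x))
          | multiplicity-∷-map false false v (map (false ∷_) (deleteTrue true x)) = refl

multiplicity-shuffleOne : ∀ g x → length x ≡ suc (length g) →
  multiplicity x (shuffleOne g) ≡ multiplicity g (deleteFalse true x) + multiplicity g (deleteTrue true x)
multiplicity-shuffleOne g (true ∷ x) |x|≡1+|g|
  rewrite multiplicity-insertTrue g x true (suc-injective |x|≡1+|g|) =
  x+[y+z]≡y+[x+z] (𝟙 (does (g ≟ x))) (multiplicity g (map (true ∷_) (deleteFalse true x))) _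
multiplicity-shuffleOne g (false ∷ x) |x|≡1+|g|
  rewrite multiplicity-insertTrue g x false (suc-injective |x|≡1+|g|) | ≟-sym x g =
  sym (+-assoc (𝟙 (does (g ≟ x))) _ _)

transposeBits-∷ : ∀ b u → transposeBits (b ∷ u) ≡ transposeBits u ++ not b ∷ []
transposeBits-∷ b u = unfold-reverse (not b) (map not u)

transposeBits-++ : ∀ u w → transposeBits (u ++ w) ≡ transposeBits w ++ transposeBits u
transposeBits-++ u w = trans (cong reverse (map-++ not u w)) (reverse-++ (map not u) (map not w))

transposeBits-involutive : ∀ u → transposeBits (transposeBits u) ≡ u
transposeBits-involutive u = begin
  reverse (map not (reverse (map not u)))   ≡⟨ cong reverse (reverse-map not (map not u)) ⟩
  reverse (reverse (map not (map not u)))   ≡⟨ reverse-involutive _ ⟩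
  map not (map not u)                       ≡⟨ sym (map-∘ u) ⟩
  map (not ∘ not) u                         ≡⟨ map-cong not-involutive u ⟩
  map id u                                  ≡⟨ map-id u ⟩
  u                                         ∎
  where open ≡-Reasoning

transposeBits-injective : Injective _≡_ _≡_ transposeBits
transposeBits-injective {u} {w} eq =
  trans (sym (transposeBits-involutive u)) (trans (cong transposeBits eq) (transposeBits-involutive w))

insertTrueInside : List Bool → List (List Bool)
insertTrueInside [] = []
insertTrueInside (b ∷ v) = (true ∷ false ∷ v) ∷ map (b ∷_) (insertTrueInside v)

insertTrue-insertTrueInside : ∀ v → insertTrue v ≡ insertTrueInside v ++ (v ++ true ∷ []) ∷ []
insertTrue-insertTrueInside [] = refl
insertTrue-insertTrueInside (b ∷ v) = cong ((true ∷ false ∷ v) ∷_)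
  (trans (cong (map (b ∷_)) (insertTrue-insertTrueInside v)) (map-++ (b ∷_) (insertTrueInside v) _))

insertTrueInside-∷ʳ : ∀ w c → insertTrueInside (w ++ c ∷ []) ≡
                      map (_++ c ∷ []) (insertTrueInside w) ++ (w ++ true ∷ false ∷ []) ∷ []
insertTrueInside-∷ʳ [] c = refl
insertTrueInside-∷ʳ (a ∷ w) c = cong ((true ∷ false ∷ w ++ c ∷ []) ∷_) (begin
  map (a ∷_) (insertTrueInside (w ++ c ∷ []))
    ≡⟨ cong (map (a ∷_)) (insertTrueInside-∷ʳ w c) ⟩
  map (a ∷_) (map (_++ c ∷ []) (insertTrueInside w) ++ (w ++ true ∷ false ∷ []) ∷ [])
    ≡⟨ map-++ (a ∷_) (map (_++ c ∷ []) (insertTrueInside w)) _ ⟩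
  map (a ∷_) (map (_++ c ∷ []) (insertTrueInside w)) ++ (a ∷ w ++ true ∷ false ∷ []) ∷ []
    ≡⟨ cong (_++ (a ∷ w ++ true ∷ false ∷ []) ∷ []) (trans (sym (map-∘ (insertTrueInside w))) (map-∘ (insertTrueInside w))) ⟩
  map (_++ c ∷ []) (map (a ∷_) (insertTrueInside w)) ++ (a ∷ w ++ true ∷ false ∷ []) ∷ [] ∎)
  where open ≡-Reasoning

map-transposeBits-insertTrueInside : ∀ v → map transposeBits (insertTrueInside v) ≡ reverse (insertTrueInside (transposeBits v))
map-transposeBits-insertTrueInside [] = refl
map-transposeBits-insertTrueInside (b ∷ v) = begin
  transposeBits (true ∷ false ∷ v) ∷ map transposeBits (map (b ∷_) (insertTrueInside v))
    ≡⟨ cong₂ _∷_ transpose-head (trans (sym (map-∘ (insertTrueInside v)))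
                                (trans (map-cong (transposeBits-∷ b) (insertTrueInside v)) (map-∘ (insertTrueInside v)))) ⟩
  (vᵀ ++ true ∷ false ∷ []) ∷ map (_++ not b ∷ []) (map transposeBits (insertTrueInside v))
    ≡⟨ cong (λ K → (vᵀ ++ true ∷ false ∷ []) ∷ map (_++ not b ∷ []) K) (map-transposeBits-insertTrueInside v) ⟩
  (vᵀ ++ true ∷ false ∷ []) ∷ map (_++ not b ∷ []) (reverse (insertTrueInside vᵀ))
    ≡⟨ cong ((vᵀ ++ true ∷ false ∷ []) ∷_) (reverse-map (_++ not b ∷ []) (insertTrueInside vᵀ)) ⟩
  (vᵀ ++ true ∷ false ∷ []) ∷ reverse (map (_++ not b ∷ []) (insertTrueInside vᵀ))
    ≡⟨ sym (reverse-++ (map (_++ not b ∷ []) (insertTrueInside vᵀ)) ((vᵀ ++ true ∷ false ∷ []) ∷ [])) ⟩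
  reverse (map (_++ not b ∷ []) (insertTrueInside vᵀ) ++ (vᵀ ++ true ∷ false ∷ []) ∷ [])
    ≡⟨ cong reverse (sym (insertTrueInside-∷ʳ vᵀ (not b))) ⟩
  reverse (insertTrueInside (vᵀ ++ not b ∷ []))
    ≡⟨ cong (reverse ∘ insertTrueInside) (sym (transposeBits-∷ b v)) ⟩
  reverse (insertTrueInside (transposeBits (b ∷ v))) ∎
  where
  open ≡-Reasoning
  vᵀ = transposeBits v
  transpose-head : transposeBits (true ∷ false ∷ v) ≡ vᵀ ++ true ∷ false ∷ []
  transpose-head = trans (transposeBits-++ (true ∷ false ∷ []) v) refl

map-transposeBits-shuffleOne : ∀ g → map transposeBits (shuffleOne g) ≡ reverse (shuffleOne (transposeBits g))
map-transposeBits-shuffleOne g = begin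
  transposeBits (false ∷ g) ∷ map transposeBits (insertTrue g)
    ≡⟨ cong₂ _∷_ (transposeBits-∷ false g)
             (trans (cong (map transposeBits) (insertTrue-insertTrueInside g)) (map-++ transposeBits (insertTrueInside g) _)) ⟩
  (gᵀ ++ true ∷ []) ∷ (map transposeBits (insertTrueInside g) ++ transposeBits (g ++ true ∷ []) ∷ [])
    ≡⟨ cong₂ (λ K u → (gᵀ ++ true ∷ []) ∷ (K ++ u ∷ [])) (map-transposeBits-insertTrueInside g) (transposeBits-++ g (true ∷ [])) ⟩
  (gᵀ ++ true ∷ []) ∷ reverse (insertTrueInside gᵀ) ++ (false ∷ gᵀ) ∷ []
    ≡⟨ cong (_++ (false ∷ gᵀ) ∷ []) (sym (reverse-++ (insertTrueInside gᵀ) ((gᵀ ++ true ∷ []) ∷ []))) ⟩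
  reverse (insertTrueInside gᵀ ++ (gᵀ ++ true ∷ []) ∷ []) ++ (false ∷ gᵀ) ∷ []
    ≡⟨ cong (λ K → reverse K ++ (false ∷ gᵀ) ∷ []) (sym (insertTrue-insertTrueInside gᵀ)) ⟩
  reverse (insertTrue gᵀ) ++ (false ∷ gᵀ) ∷ []
    ≡⟨ sym (unfold-reverse (false ∷ gᵀ) (insertTrue gᵀ)) ⟩
  reverse (shuffleOne gᵀ) ∎
  where
  open ≡-Reasoning
  gᵀ = transposeBits g

multiplicity-shuffleOne-transposeBits : ∀ g x → multiplicity (transposeBits x) (shuffleOne (transposeBits g)) ≡ multiplicity x (shuffleOne g)
multiplicity-shuffleOne-transposeBits g x = begin
  multiplicity (transposeBits x) (shuffleOne (transposeBits g))
    ≡⟨ sym (countᵇ-reverse _ (shuffleOne (transposeBits g))) ⟩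
  multiplicity (transposeBits x) (reverse (shuffleOne (transposeBits g)))
    ≡⟨ cong (multiplicity (transposeBits x)) (sym (map-transposeBits-shuffleOne g)) ⟩
  multiplicity (transposeBits x) (map transposeBits (shuffleOne g))
    ≡⟨ multiplicity-map transposeBits-injective x (shuffleOne g) ⟩
  multiplicity x (shuffleOne g) ∎
  where open ≡-Reasoning

#true #false : List Bool → ℕ
#true = countᵇ id
#false = countᵇ not

#true-deleteFalse : ∀ p x → All (λ u → #true u ≡ #true x) (deleteFalse p x)
#true-deleteFalse p [] = []
#true-deleteFalse p (true ∷ x) = All.map⁺ {f = true ∷_} (All.map (cong suc) (#true-deleteFalse true x))
#true-deleteFalse true (false ∷ x) = refl ∷ All.map⁺ {f = false ∷_} (#true-deleteFalse false x)
#true-deleteFalse false (false ∷ x) = All.map⁺ {f = false ∷_} (#true-deleteFalse false x)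

#true-deleteTrue : ∀ p x → All (λ u → suc (#true u) ≡ #true x) (deleteTrue p x)
#true-deleteTrue p [] = []
#true-deleteTrue true (true ∷ x) = refl ∷ All.map⁺ {f = true ∷_} (All.map (cong suc) (#true-deleteTrue false x))
#true-deleteTrue false (true ∷ x) = All.map⁺ {f = true ∷_} (All.map (cong suc) (#true-deleteTrue false x))
#true-deleteTrue p (false ∷ x) = All.map⁺ {f = false ∷_} (#true-deleteTrue true x)

#true-transposeBits : ∀ u → #true (transposeBits u) ≡ #false u
#true-transposeBits u = trans (countᵇ-reverse id (map not u)) (countᵇ-map id not u)

multiplicity-unreachable : ∀ (f : List Bool → ℕ) g L → All (λ u → f u ≢ f g) L → multiplicity g L ≡ 0
multiplicity-unreachable f g L fu≢fg =
  countᵇ-none _ L (All.map (λ {u} fu≢fg → dec-false (g ≟ u) (fu≢fg ∘ cong f ∘ sym)) fu≢fg)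

multiplicity-deleteFalse-≢ : ∀ g x → #true x ≢ #true g → multiplicity g (deleteFalse true x) ≡ 0
multiplicity-deleteFalse-≢ g x #x≢#g =
  multiplicity-unreachable #true g _ (All.map (λ #u≡#x → #x≢#g ∘ trans (sym #u≡#x)) (#true-deleteFalse true x))

multiplicity-deleteTrue-≢ : ∀ g x → #true x ≢ suc (#true g) → multiplicity g (deleteTrue true x) ≡ 0
multiplicity-deleteTrue-≢ g x #x≢1+#g =
  multiplicity-unreachable (suc ∘ #true) g _ (All.map (λ 1+#u≡#x → #x≢1+#g ∘ trans (sym 1+#u≡#x)) (#true-deleteTrue true x))

length-transposeBits : ∀ u → length (transposeBits u) ≡ length u
length-transposeBits u = trans (length-reverse (map not u)) (length-map not u)

module _ (x g : List Bool) (|x|≡1+|g| : length x ≡ suc (length g)) where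

  #false+#true-balance : #false x + #true x ≡ #false g + suc (#true g)
  #false+#true-balance = begin
    #false x + #true x          ≡⟨ countᵇ-not+countᵇ id x ⟩
    length x                    ≡⟨ |x|≡1+|g| ⟩
    suc (length g)              ≡⟨ cong suc (sym (countᵇ-not+countᵇ id g)) ⟩
    suc (#false g + #true g)    ≡⟨ sym (+-suc (#false g) (#true g)) ⟩
    #false g + suc (#true g)    ∎
    where open ≡-Reasoning

  #false≡⇒#true≡suc : #false x ≡ #false g → #true x ≡ suc (#true g)
  #false≡⇒#true≡suc #x≡#g = +-cancelˡ-≡ (#false g) _ _ (trans (cong (_+ #true x) (sym #x≡#g)) #false+#true-balance)

  #true≡suc⇒#false≡ : #true x ≡ suc (#true g) → #false x ≡ #false g
  #true≡suc⇒#false≡ #x≡1+#g = +-cancelʳ-≡ (suc (#true g)) _ _ (trans (cong (λ k → #false x + k) (sym #x≡1+#g)) #false+#true-balance)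

-- Deleting a false keeps the number of trues and deleting a true lowers it, so at most one of the two
-- counts of multiplicity-shuffleOne is nonzero; when it is the true-deletions, the transposition symmetry
-- of shuffleOne turns them into false-deletions of the transposed word.
multiplicity-shuffleOne-deleteFalse : ∀ g x → length x ≡ suc (length g) →
  multiplicity x (shuffleOne g) ≡ multiplicity g (deleteFalse true x) + multiplicity (transposeBits g) (deleteFalse true (transposeBits x))
multiplicity-shuffleOne-deleteFalse g x |x|≡1+|g| with #true x ≟ℕ suc (#true g)
... | yes #x≡1+#g = begin
  multiplicity x (shuffleOne g)
    ≡⟨ sym (multiplicity-shuffleOne-transposeBits g x) ⟩
  multiplicity xᵀ (shuffleOne gᵀ)
    ≡⟨ multiplicity-shuffleOne gᵀ xᵀ |xᵀ|≡1+|gᵀ| ⟩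
  multiplicity gᵀ (deleteFalse true xᵀ) + multiplicity gᵀ (deleteTrue true xᵀ)
    ≡⟨ cong₂ _+_ refl (multiplicity-deleteTrue-≢ gᵀ xᵀ #xᵀ≢1+#gᵀ) ⟩
  multiplicity gᵀ (deleteFalse true xᵀ) + 0
    ≡⟨ +-comm _ 0 ⟩
  0 + multiplicity gᵀ (deleteFalse true xᵀ)
    ≡⟨ cong (_+ multiplicity gᵀ (deleteFalse true xᵀ)) (sym (multiplicity-deleteFalse-≢ g x #x≢#g)) ⟩
  multiplicity g (deleteFalse true x) + multiplicity gᵀ (deleteFalse true xᵀ) ∎
  where
  open ≡-Reasoning
  xᵀ = transposeBits x
  gᵀ = transposeBits g
  |xᵀ|≡1+|gᵀ| : length xᵀ ≡ suc (length gᵀ)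
  |xᵀ|≡1+|gᵀ| = trans (length-transposeBits x) (trans |x|≡1+|g| (cong suc (sym (length-transposeBits g))))
  #x≢#g : #true x ≢ #true g
  #x≢#g eq = 1+n≢n (trans (sym #x≡1+#g) eq)
  #xᵀ≢1+#gᵀ : #true xᵀ ≢ suc (#true gᵀ)
  #xᵀ≢1+#gᵀ eq = 1+n≢n (sym (begin
    #false g           ≡⟨ sym (#true≡suc⇒#false≡ x g |x|≡1+|g| #x≡1+#g) ⟩
    #false x           ≡⟨ sym (#true-transposeBits x) ⟩
    #true xᵀ           ≡⟨ eq ⟩
    suc (#true gᵀ)     ≡⟨ cong suc (#true-transposeBits g) ⟩
    suc (#false g)     ∎))
... | no #x≢1+#g = begin
  multiplicity x (shuffleOne g)
    ≡⟨ multiplicity-shuffleOne g x |x|≡1+|g| ⟩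
  multiplicity g (deleteFalse true x) + multiplicity g (deleteTrue true x)
    ≡⟨ cong₂ _+_ refl (trans (multiplicity-deleteTrue-≢ g x #x≢1+#g) (sym (multiplicity-deleteFalse-≢ gᵀ xᵀ #xᵀ≢#gᵀ))) ⟩
  multiplicity g (deleteFalse true x) + multiplicity gᵀ (deleteFalse true xᵀ) ∎
  where
  open ≡-Reasoning
  xᵀ = transposeBits x
  gᵀ = transposeBits g
  #xᵀ≢#gᵀ : #true xᵀ ≢ #true gᵀ
  #xᵀ≢#gᵀ eq = #x≢1+#g (#false≡⇒#true≡suc x g |x|≡1+|g| (begin
    #false x    ≡⟨ sym (#true-transposeBits x) ⟩
    #true xᵀ    ≡⟨ eq ⟩
    #true gᵀ    ≡⟨ #true-transposeBits g ⟩
    #false g    ∎))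

ribbonCoeff-rhs-fromBits : ∀ g x → length x ≡ suc (length g) →
                           ribbonCoeff (rhs (fromBits x)) (fromBits g) ≡ + multiplicity x (shuffleOne g)
ribbonCoeff-rhs-fromBits g x |x|≡1+|g| = begin
  ribbonCoeff (rhs (fromBits x)) (fromBits g)
    ≡⟨ cong (λ H → ribbonCoeff H (fromBits g)) (rhs-fromBits x) ⟩
  ribbonCoeff (map fromBits (Dx ++ map transposeBits Dxᵀ)) (fromBits g)
    ≡⟨ ribbonCoeff-fromBits (Dx ++ map transposeBits Dxᵀ) g ⟩
  + multiplicity g (Dx ++ map transposeBits Dxᵀ)
    ≡⟨ cong +_ (countᵇ-++ _ Dx (map transposeBits Dxᵀ)) ⟩
  + (multiplicity g Dx + multiplicity g (map transposeBits Dxᵀ))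
    ≡⟨ cong (λ k → + (multiplicity g Dx + k)) (begin
         multiplicity g (map transposeBits Dxᵀ)
           ≡⟨ cong (λ u → multiplicity u (map transposeBits Dxᵀ)) (sym (transposeBits-involutive g)) ⟩
         multiplicity (transposeBits (transposeBits g)) (map transposeBits Dxᵀ)
           ≡⟨ multiplicity-map transposeBits-injective (transposeBits g) Dxᵀ ⟩
         multiplicity (transposeBits g) Dxᵀ ∎) ⟩
  + (multiplicity g Dx + multiplicity (transposeBits g) Dxᵀ)
    ≡⟨ cong +_ (sym (multiplicity-shuffleOne-deleteFalse g x |x|≡1+|g|)) ⟩
  + multiplicity x (shuffleOne g) ∎
  where
  open ≡-Reasoning
  Dx = deleteFalse true x
  Dxᵀ = deleteFalse true (transposeBits x)

-- Evaluating L at a monomial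

ascentMask : List ℕ → List Bool
ascentMask [] = []
ascentMask (x ∷ []) = true ∷ []
ascentMask (x ∷ y ∷ w) = (x <ᵇ y) ∷ ascentMask (y ∷ w)

descentMask : List ℕ → List Bool
descentMask [] = []
descentMask (a ∷ α) = replicate (a ∸ 1) false ++ true ∷ descentMask α

descentMask-fromBits : ∀ t → descentMask (fromBits t) ≡ t ++ true ∷ []
descentMask-fromBits [] = refl
descentMask-fromBits (true ∷ t) = cong (true ∷_) (descentMask-fromBits t)
descentMask-fromBits (false ∷ t) = cong (false ∷_) (descentMask-fromBits t)

strictAt : List ℕ → ℕ → Bool
strictAt w d = lookupD w (d ∸ 1) <ᵇ lookupD w d

lookupD-drop : ∀ w a j → lookupD w (a + j) ≡ lookupD (drop a w) j
lookupD-drop w zero j = refl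
lookupD-drop [] (suc a) j = refl
lookupD-drop (x ∷ w) (suc a) j = lookupD-drop w a j

allᵇ-strictAt-drop : ∀ a D w → All (1 ≤_) D → allᵇ (map (λ x → a + x) D) (strictAt w) ≡ allᵇ D (strictAt (drop a w))
allᵇ-strictAt-drop a [] w [] = refl
allᵇ-strictAt-drop a (suc d ∷ D) w (_ ∷ D⁺) = cong₂ _∧_ shift (allᵇ-strictAt-drop a D w D⁺)
  where
  shift : strictAt w (a + suc d) ≡ strictAt (drop a w) (suc d)
  shift = trans (cong (λ i → lookupD w (i ∸ 1) <ᵇ lookupD w (a + suc d)) (+-suc a d))
                (cong₂ _<ᵇ_ (lookupD-drop w a d) (lookupD-drop w a (suc d)))

des-positive : ∀ δ → All (1 ≤_) δ → All (1 ≤_) (des δ)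
des-positive [] _ = []
des-positive (a ∷ []) _ = []
des-positive (a ∷ b ∷ δ) (1≤a ∷ δ⁺) = 1≤a ∷ All.map⁺ (All.map (λ {d} 1≤d → ≤-trans 1≤d (m≤n+m d a)) (des-positive (b ∷ δ) δ⁺))

falses-true-⊆ᵇ-ascentMask : ∀ k w → length w ≡ suc k → ((replicate k false ++ true ∷ []) ⊆ᵇ ascentMask w) ≡ true
falses-true-⊆ᵇ-ascentMask zero (x ∷ []) _ = refl
falses-true-⊆ᵇ-ascentMask (suc k) (x ∷ y ∷ w) |w|≡ = falses-true-⊆ᵇ-ascentMask k (y ∷ w) (suc-injective |w|≡)

falses-true-⊆ᵇ-ascentMask-++ : ∀ k z w → suc (suc k) ≤ length w →
  ((replicate k false ++ true ∷ z) ⊆ᵇ ascentMask w) ≡ strictAt w (suc k) ∧ (z ⊆ᵇ ascentMask (drop (suc k) w))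
falses-true-⊆ᵇ-ascentMask-++ zero z (x ∷ []) (s≤s ())
falses-true-⊆ᵇ-ascentMask-++ zero z (x ∷ y ∷ w) _ = refl
falses-true-⊆ᵇ-ascentMask-++ (suc k) z (x ∷ y ∷ w) (s≤s 2+k≤) = falses-true-⊆ᵇ-ascentMask-++ k z (y ∷ w) 2+k≤

descents-strict-⊆ᵇ : ∀ δ w → All (1 ≤_) δ → length w ≡ sum δ →
                     allᵇ (des δ) (strictAt w) ≡ (descentMask δ ⊆ᵇ ascentMask w)
descents-strict-⊆ᵇ [] [] _ _ = refl
descents-strict-⊆ᵇ (zero ∷ _) w (() ∷ _) _
descents-strict-⊆ᵇ (suc a ∷ []) w _ |w|≡ = sym (falses-true-⊆ᵇ-ascentMask a w (trans |w|≡ (+-identityʳ (suc a))))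
descents-strict-⊆ᵇ (suc a ∷ b ∷ δ) w (_ ∷ b∷δ⁺) |w|≡ = begin
  strictAt w (suc a) ∧ allᵇ (map (λ x → suc a + x) (des (b ∷ δ))) (strictAt w)
    ≡⟨ cong (strictAt w (suc a) ∧_) (allᵇ-strictAt-drop (suc a) (des (b ∷ δ)) w (des-positive (b ∷ δ) b∷δ⁺)) ⟩
  strictAt w (suc a) ∧ allᵇ (des (b ∷ δ)) (strictAt (drop (suc a) w))
    ≡⟨ cong (strictAt w (suc a) ∧_) (descents-strict-⊆ᵇ (b ∷ δ) (drop (suc a) w) b∷δ⁺ |drop|≡) ⟩
  strictAt w (suc a) ∧ (descentMask (b ∷ δ) ⊆ᵇ ascentMask (drop (suc a) w))
    ≡⟨ sym (falses-true-⊆ᵇ-ascentMask-++ a (descentMask (b ∷ δ)) w 2+a≤|w|) ⟩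
  (descentMask (suc a ∷ b ∷ δ) ⊆ᵇ ascentMask w) ∎
  where
  open ≡-Reasoning
  |drop|≡ : length (drop (suc a) w) ≡ sum (b ∷ δ)
  |drop|≡ = trans (length-drop (suc a) w) (trans (cong (_∸ suc a) |w|≡) (m+n∸m≡n (suc a) (sum (b ∷ δ))))
  2+a≤|w| : suc (suc a) ≤ length w
  2+a≤|w| = subst (suc (suc a) ≤_) (sym |w|≡) (subst (_≤ suc a + sum (b ∷ δ)) (+-comm (suc a) 1)
              (+-monoʳ-≤ (suc a) (≤-trans (All.head b∷δ⁺) (m≤m+n b (sum δ)))))

if-𝟙 : ∀ b → (if b then + 1 else + 0) ≡ + 𝟙 b
if-𝟙 true = refl
if-𝟙 false = refl

-- L δ N e unfolds to Lword δ (wordFrom 1 e).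
Lword : List ℕ → List ℕ → ℤ
Lword δ w = if (length w ≡ᵇ sum δ) ∧ allᵇ (des δ) (strictAt w) then + 1 else + 0

Lword-ascentMask : ∀ δ w → All (1 ≤_) δ → length w ≡ sum δ → Lword δ w ≡ + 𝟙 (descentMask δ ⊆ᵇ ascentMask w)
Lword-ascentMask δ w δ⁺ |w|≡Σδ =
  trans (cong (λ b → if b then + 1 else + 0)
              (cong₂ _∧_ (Equivalence.to T-≡ (≡⇒≡ᵇ _ _ |w|≡Σδ)) (descents-strict-⊆ᵇ δ w δ⁺ |w|≡Σδ)))
        (if-𝟙 _)

length-wordFrom : ∀ {N} k (e : Vec ℕ N) → length (wordFrom k e) ≡ Vec.sum e
length-wordFrom k [] = refl
length-wordFrom k (x ∷ e) = trans (length-++ (replicate x k)) (cong₂ _+_ (length-replicate x) (length-wordFrom (suc k) e))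

L-one : ∀ N (e : Vec ℕ N) → L (1 ∷ []) N e ≡ + 𝟙 (Vec.sum e ≡ᵇ 1)
L-one N e = trans (cong (λ b → if b then + 1 else + 0) (trans (∧-identityʳ _) (cong (_≡ᵇ 1) (length-wordFrom 1 e)))) (if-𝟙 _)

<ᵇ-suc : ∀ k → (k <ᵇ suc k) ≡ true
<ᵇ-suc k = Equivalence.to T-≡ (<⇒<ᵇ (n<1+n k))

<ᵇ-irrefl : ∀ k → (k <ᵇ k) ≡ false
<ᵇ-irrefl zero = refl
<ᵇ-irrefl (suc k) = <ᵇ-irrefl k

ascentMask-wordFrom-fromBits : ∀ k s → ascentMask (wordFrom k (Vec.fromList (fromBits s))) ≡ s ++ true ∷ []
ascentMask-wordFrom-fromBits k [] = refl
ascentMask-wordFrom-fromBits k (true ∷ s) = cong₂ _∷_ (<ᵇ-suc k) (ascentMask-wordFrom-fromBits (suc k) s)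
ascentMask-wordFrom-fromBits k (false ∷ s) = cong₂ _∷_ (<ᵇ-irrefl k) (ascentMask-wordFrom-fromBits k s)

⊆ᵇ-∷ʳ-true : ∀ t s → ((t ++ true ∷ []) ⊆ᵇ (s ++ true ∷ [])) ≡ (t ⊆ᵇ s)
⊆ᵇ-∷ʳ-true [] [] = refl
⊆ᵇ-∷ʳ-true [] (y ∷ s) = trans (cong (y ∧_) (lemma s)) (∧-zeroʳ y)
  where
  lemma : ∀ s → ([] ⊆ᵇ (s ++ true ∷ [])) ≡ false
  lemma [] = refl
  lemma (_ ∷ _) = refl
⊆ᵇ-∷ʳ-true (x ∷ t) [] = trans (cong ((not x ∨ true) ∧_) (lemma t)) (∧-zeroʳ _)
  where
  lemma : ∀ t → ((t ++ true ∷ []) ⊆ᵇ []) ≡ false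
  lemma [] = refl
  lemma (_ ∷ _) = refl
⊆ᵇ-∷ʳ-true (x ∷ t) (y ∷ s) = cong ((not x ∨ y) ∧_) (⊆ᵇ-∷ʳ-true t s)

sum-fromList : ∀ β → Vec.sum (Vec.fromList β) ≡ sum β
sum-fromList [] = refl
sum-fromList (a ∷ β) = cong₂ _+_ refl (sum-fromList β)

-- At the monomial x^β whose exponent vector is β = fromBits s itself, the word has ascent mask s ++ [true],
-- so L_(fromBits t) there is the indicator of t ⊆ s.
L-fromBits-at-fromBits : ∀ t s → length t ≡ length s →
  L (fromBits t) (length (fromBits s)) (Vec.fromList (fromBits s)) ≡ + 𝟙 (t ⊆ᵇ s)
L-fromBits-at-fromBits t s |t|≡|s| = begin
  Lword (fromBits t) w
    ≡⟨ Lword-ascentMask (fromBits t) w (fromBits-positive t) |w|≡Σ ⟩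
  + 𝟙 (descentMask (fromBits t) ⊆ᵇ ascentMask w)
    ≡⟨ cong₂ (λ u v → + 𝟙 (u ⊆ᵇ v)) (descentMask-fromBits t) (ascentMask-wordFrom-fromBits 1 s) ⟩
  + 𝟙 ((t ++ true ∷ []) ⊆ᵇ (s ++ true ∷ []))
    ≡⟨ cong (+_ ∘ 𝟙) (⊆ᵇ-∷ʳ-true t s) ⟩
  + 𝟙 (t ⊆ᵇ s) ∎
  where
  open ≡-Reasoning
  w = wordFrom 1 (Vec.fromList (fromBits s))
  |w|≡Σ : length w ≡ sum (fromBits t)
  |w|≡Σ = trans (length-wordFrom 1 (Vec.fromList (fromBits s)))
         (trans (sum-fromList (fromBits s)) (trans (sum-fromBits s) (trans (cong suc (sym |t|≡|s|)) (sym (sum-fromBits t)))))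

sumℤ-below-weight₀ : ∀ {N} (e : Vec ℕ N) (H : Vec ℕ N → ℤ) →
  sumℤ (map (λ e₁ → + 𝟙 (Vec.sum e₁ ≡ᵇ 0) *ℤ H e₁) (below e)) ≡ H (Vec.replicate N 0)
sumℤ-below-weight₀ [] H = trans (ℤ.+-identityʳ _) (ℤ.*-identityˡ (H []))
sumℤ-below-weight₀ (x ∷ e) H = begin
  sumℤ (map Φ (concatMap (λ i → map (i ∷_) (below e)) (upTo (suc x))))
    ≡⟨ sumℤ-concatMap Φ (λ i → map (i ∷_) (below e)) (upTo (suc x)) ⟩
  sumℤ (map Φ (map (0 ∷_) (below e))) +ℤ sumℤ (map (λ i → sumℤ (map Φ (map (i ∷_) (below e)))) (applyUpTo suc x))
    ≡⟨ cong₂ _+ℤ_ (trans (cong sumℤ (sym (map-∘ (below e)))) (sumℤ-below-weight₀ e (H ∘ (0 ∷_))))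
                  (sumℤ-zero _ (applyUpTo suc x) (All.applyUpTo⁺₂ suc x λ j →
                     trans (cong sumℤ (sym (map-∘ (below e))))
                           (sumℤ-zero _ (below e) (All.tabulate λ {e₁} _ → ℤ.*-zeroˡ (H (suc j ∷ e₁)))))) ⟩
  H (0 ∷ Vec.replicate _ 0) +ℤ + 0
    ≡⟨ ℤ.+-identityʳ _ ⟩
  H (0 ∷ Vec.replicate _ 0) ∎
  where
  open ≡-Reasoning
  Φ = λ e₁ → + 𝟙 (Vec.sum e₁ ≡ᵇ 0) *ℤ H e₁

-- The product with L_(1)

∸v-replicate-0 : ∀ {N} (e : Vec ℕ N) → e ∸v Vec.replicate N 0 ≡ e
∸v-replicate-0 [] = refl
∸v-replicate-0 (x ∷ e) = cong (x ∷_) (∸v-replicate-0 e)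

-- deleteFirsts w lists the words obtained from w by deleting an entry that differs from its predecessor;
-- for weakly increasing w these are the first occurrences of its letters.
deleteFirstsAfter : ℕ → List ℕ → List (List ℕ)
deleteFirstsAfter p [] = []
deleteFirstsAfter p (y ∷ w) = (if p ≡ᵇ y then [] else w ∷ []) ++ map (y ∷_) (deleteFirstsAfter y w)

deleteFirsts : List ℕ → List (List ℕ)
deleteFirsts [] = []
deleteFirsts (x ∷ w) = w ∷ map (x ∷_) (deleteFirstsAfter x w)

deleteFirstsAfter-replicate : ∀ a k w → deleteFirstsAfter k (replicate a k ++ w) ≡ map (replicate a k ++_) (deleteFirstsAfter k w)
deleteFirstsAfter-replicate zero k w = sym (map-id (deleteFirstsAfter k w))
deleteFirstsAfter-replicate (suc a) k w rewrite ≡ᵇ-refl k | deleteFirstsAfter-replicate a k w = sym (map-∘ (deleteFirstsAfter k w))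

deleteFirstsAfter-fresh : ∀ k w → All (k <_) w → deleteFirstsAfter k w ≡ deleteFirsts w
deleteFirstsAfter-fresh k [] _ = refl
deleteFirstsAfter-fresh k (y ∷ w) (k<y ∷ _) rewrite dec-false (k ≟ℕ y) (<⇒≢ k<y) = refl

wordFrom-≥ : ∀ {N} k (e : Vec ℕ N) → All (k ≤_) (wordFrom k e)
wordFrom-≥ k [] = []
wordFrom-≥ k (x ∷ e) = ++⁺ (All.replicate⁺ x ≤-refl) (All.map (≤-trans (n≤1+n k)) (wordFrom-≥ (suc k) e))

-- Multiplying by L_(1) = x₁ + x₂ + ⋯ removes one letter from the word; only removals at first occurrences
-- leave a weakly increasing word.
sumℤ-below-weight₁ : ∀ {N} (e : Vec ℕ N) k (G : List ℕ → ℤ) →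
  sumℤ (map (λ e₁ → + 𝟙 (Vec.sum e₁ ≡ᵇ 1) *ℤ G (wordFrom k (e ∸v e₁))) (below e)) ≡ sumℤ (map G (deleteFirsts (wordFrom k e)))
sumℤ-below-weight₁ [] k G = trans (ℤ.+-identityʳ _) (ℤ.*-zeroˡ (G []))
sumℤ-below-weight₁ (zero ∷ e) k G = begin
  sumℤ (map Φ (concatMap (λ i → map (i ∷_) (below e)) (upTo 1)))
    ≡⟨ sumℤ-concatMap Φ (λ i → map (i ∷_) (below e)) (upTo 1) ⟩
  sumℤ (map Φ (map (0 ∷_) (below e))) +ℤ + 0
    ≡⟨ ℤ.+-identityʳ _ ⟩
  sumℤ (map Φ (map (0 ∷_) (below e)))
    ≡⟨ cong sumℤ (sym (map-∘ (below e))) ⟩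
  sumℤ (map (Φ ∘ (0 ∷_)) (below e))
    ≡⟨ sumℤ-below-weight₁ e (suc k) G ⟩
  sumℤ (map G (deleteFirsts (wordFrom (suc k) e))) ∎
  where
  open ≡-Reasoning
  Φ = λ e₁ → + 𝟙 (Vec.sum e₁ ≡ᵇ 1) *ℤ G (wordFrom k ((zero ∷ e) ∸v e₁))
sumℤ-below-weight₁ (suc x ∷ e) k G = begin
  sumℤ (map Φ (concatMap (λ i → map (i ∷_) (below e)) (upTo (suc (suc x)))))
    ≡⟨ sumℤ-concatMap Φ (λ i → map (i ∷_) (below e)) (upTo (suc (suc x))) ⟩
  slice 0 +ℤ (slice 1 +ℤ sumℤ (map slice (applyUpTo (suc ∘ suc) x)))
    ≡⟨ cong₂ _+ℤ_ slice₀ (cong₂ _+ℤ_ slice₁ (sumℤ-zero slice (applyUpTo (suc ∘ suc) x) (All.applyUpTo⁺₂ (suc ∘ suc) x slice≥2))) ⟩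
  A +ℤ (G (replicate x k ++ W) +ℤ + 0)
    ≡⟨ trans (cong (A +ℤ_) (ℤ.+-identityʳ (G (replicate x k ++ W)))) (ℤ.+-comm A _) ⟩
  G (replicate x k ++ W) +ℤ A
    ≡⟨ cong (λ D → G (replicate x k ++ W) +ℤ sumℤ (map G (map (k ∷_) D))) (sym deletions) ⟩
  sumℤ (map G (deleteFirsts (wordFrom k (suc x ∷ e)))) ∎
  where
  open ≡-Reasoning
  Φ = λ e₁ → + 𝟙 (Vec.sum e₁ ≡ᵇ 1) *ℤ G (wordFrom k ((suc x ∷ e) ∸v e₁))
  W = wordFrom (suc k) e
  slice : ℕ → ℤ
  slice i = sumℤ (map Φ (map (i ∷_) (below e)))
  A = sumℤ (map G (map (k ∷_) (map (replicate x k ++_) (deleteFirsts W))))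
  slice₀ : slice 0 ≡ A
  slice₀ = trans (cong sumℤ (sym (map-∘ (below e))))
       (trans (sumℤ-below-weight₁ e (suc k) (G ∘ (replicate (suc x) k ++_)))
              (cong sumℤ (trans (map-∘ (deleteFirsts W)) (map-∘ (map (replicate x k ++_) (deleteFirsts W))))))
  slice₁ : slice 1 ≡ G (replicate x k ++ W)
  slice₁ = trans (cong sumℤ (sym (map-∘ (below e))))
       (trans (sumℤ-below-weight₀ e (λ e₁ → G (replicate x k ++ wordFrom (suc k) (e ∸v e₁))))
              (cong (λ e′ → G (replicate x k ++ wordFrom (suc k) e′)) (∸v-replicate-0 e)))
  slice≥2 : ∀ j → slice (suc (suc j)) ≡ + 0
  slice≥2 j = trans (cong sumℤ (sym (map-∘ (below e))))
          (sumℤ-zero _ (below e) (All.tabulate λ {e₁} _ → ℤ.*-zeroˡ (G (wordFrom k ((suc x ∷ e) ∸v (suc (suc j) ∷ e₁))))))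
  deletions : deleteFirstsAfter k (replicate x k ++ W) ≡ map (replicate x k ++_) (deleteFirsts W)
  deletions = trans (deleteFirstsAfter-replicate x k W) (cong (map (replicate x k ++_)) (deleteFirstsAfter-fresh k W (wordFrom-≥ (suc k) e)))

deletions : List Bool → List (List Bool)
deletions [] = []
deletions (x ∷ s) = s ∷ map (x ∷_) (deletions s)

select : {A : Set} → List Bool → List A → List A
select [] _ = []
select (_ ∷ _) [] = []
select (true ∷ fs) (x ∷ xs) = x ∷ select fs xs
select (false ∷ fs) (x ∷ xs) = select fs xs

select-map : ∀ {A B : Set} (f : A → B) fs xs → select fs (map f xs) ≡ map f (select fs xs)
select-map f [] xs = refl
select-map f (_ ∷ _) [] = refl
select-map f (true ∷ fs) (x ∷ xs) = cong (f x ∷_) (select-map f fs xs)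
select-map f (false ∷ fs) (x ∷ xs) = select-map f fs xs

≡ᵇ-not-<ᵇ : ∀ {x y} → x ≤ y → (x ≡ᵇ y) ≡ not (x <ᵇ y)
≡ᵇ-not-<ᵇ {zero} {zero} _ = refl
≡ᵇ-not-<ᵇ {zero} {suc y} _ = refl
≡ᵇ-not-<ᵇ {suc x} {suc y} (s≤s x≤y) = ≡ᵇ-not-<ᵇ x≤y

<ᵇ-≤-trans : ∀ {x y z} → (x <ᵇ y) ≡ true → y ≤ z → (x <ᵇ z) ≡ true
<ᵇ-≤-trans {x} {y} {z} x<ᵇy y≤z =
  Equivalence.to T-≡ (<⇒<ᵇ (<-≤-trans (<ᵇ⇒< x y (Equivalence.from T-≡ x<ᵇy)) y≤z))

-- Deleting y from x ∷ y ∷ z ∷ … (x < y ≤ z) merges the ascents x < y and y ≤ z into x < z, whose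
-- strictness is that of y ≤ z; so the ascent mask loses the bit at y's position.
ascentMask-deleteFirstsAfter : ∀ x y r → x ≤ y → Linked _≤_ (y ∷ r) →
  map (ascentMask ∘ (x ∷_)) (deleteFirstsAfter x (y ∷ r)) ≡
  select ((x <ᵇ y) ∷ ascentMask (y ∷ r)) (map ((x <ᵇ y) ∷_) (deletions (ascentMask (y ∷ r))))
ascentMask-deleteFirstsAfter x y [] x≤y _ rewrite ≡ᵇ-not-<ᵇ x≤y with x <ᵇ y
... | true = refl
... | false = refl
ascentMask-deleteFirstsAfter x y (z ∷ r) x≤y (y≤z ∷ z∷r↑) rewrite ≡ᵇ-not-<ᵇ x≤y with x <ᵇ y in x<ᵇy | later
  where
  later : map (ascentMask ∘ (x ∷_)) (map (y ∷_) (deleteFirstsAfter y (z ∷ r))) ≡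
          select ((y <ᵇ z) ∷ ascentMask (z ∷ r)) (map ((x <ᵇ y) ∷_) (map ((y <ᵇ z) ∷_) (deletions (ascentMask (z ∷ r)))))
  later = begin
    map (ascentMask ∘ (x ∷_)) (map (y ∷_) (deleteFirstsAfter y (z ∷ r)))
      ≡⟨ trans (sym (map-∘ _)) (map-∘ _) ⟩
    map ((x <ᵇ y) ∷_) (map (ascentMask ∘ (y ∷_)) (deleteFirstsAfter y (z ∷ r)))
      ≡⟨ cong (map ((x <ᵇ y) ∷_)) (ascentMask-deleteFirstsAfter y z r y≤z z∷r↑) ⟩
    map ((x <ᵇ y) ∷_) (select ((y <ᵇ z) ∷ ascentMask (z ∷ r)) (map ((y <ᵇ z) ∷_) (deletions (ascentMask (z ∷ r)))))
      ≡⟨ sym (select-map ((x <ᵇ y) ∷_) ((y <ᵇ z) ∷ ascentMask (z ∷ r)) (map ((y <ᵇ z) ∷_) (deletions (ascentMask (z ∷ r))))) ⟩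
    select ((y <ᵇ z) ∷ ascentMask (z ∷ r)) (map ((x <ᵇ y) ∷_) (map ((y <ᵇ z) ∷_) (deletions (ascentMask (z ∷ r))))) ∎
    where open ≡-Reasoning
... | true | later′ rewrite <ᵇ-≤-trans x<ᵇy y≤z = cong ((true ∷ ascentMask (z ∷ r)) ∷_) later′
... | false | later′ = later′

ascentMask-deleteFirsts : ∀ w → Linked _≤_ w → map ascentMask (deleteFirsts w) ≡ select (true ∷ ascentMask w) (deletions (ascentMask w))
ascentMask-deleteFirsts [] _ = refl
ascentMask-deleteFirsts (x ∷ []) _ = refl
ascentMask-deleteFirsts (x ∷ y ∷ r) (x≤y ∷ y∷r↑) =
  cong (ascentMask (y ∷ r) ∷_) (trans (sym (map-∘ (deleteFirstsAfter x (y ∷ r)))) (ascentMask-deleteFirstsAfter x y r x≤y y∷r↑))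

length-deleteFirstsAfter : ∀ p w → All (λ u → suc (length u) ≡ length w) (deleteFirstsAfter p w)
length-deleteFirstsAfter p [] = []
length-deleteFirstsAfter p (y ∷ w) with p ≡ᵇ y
... | true = All.map⁺ (All.map (cong suc) (length-deleteFirstsAfter y w))
... | false = refl ∷ All.map⁺ (All.map (cong suc) (length-deleteFirstsAfter y w))

length-deleteFirsts : ∀ w → All (λ u → suc (length u) ≡ length w) (deleteFirsts w)
length-deleteFirsts [] = []
length-deleteFirsts (x ∷ w) = refl ∷ All.map⁺ (All.map (cong suc) (length-deleteFirstsAfter x w))

linked-weaken : ∀ {j k w} → j ≤ k → Linked _≤_ (k ∷ w) → Linked _≤_ (j ∷ w)
linked-weaken j≤k [-] = [-]
linked-weaken j≤k (k≤y ∷ y∷w↑) = ≤-trans j≤k k≤y ∷ y∷w↑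

wordFrom-linked : ∀ {N} k (e : Vec ℕ N) → Linked _≤_ (k ∷ wordFrom k e)
wordFrom-linked k [] = [-]
wordFrom-linked k (x ∷ e) = replicate-linked x (linked-weaken (n≤1+n k) (wordFrom-linked (suc k) e))
  where
  replicate-linked : ∀ {W} a → Linked _≤_ (k ∷ W) → Linked _≤_ (k ∷ replicate a k ++ W)
  replicate-linked zero k∷W↑ = k∷W↑
  replicate-linked (suc a) k∷W↑ = ≤-refl ∷ replicate-linked a k∷W↑

countᵇ-⊆ᵇ-insertTrue : ∀ g x s → length s ≡ length g →
  countᵇ (_⊆ᵇ (x ∷ s)) (insertTrue g) ≡
  countᵇ ((g ++ true ∷ []) ⊆ᵇ_) (select (x ∷ s ++ true ∷ []) (map (x ∷_) (deletions (s ++ true ∷ []))))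
countᵇ-⊆ᵇ-insertTrue [] true [] _ = refl
countᵇ-⊆ᵇ-insertTrue [] false [] _ = refl
countᵇ-⊆ᵇ-insertTrue (b ∷ v) x (y ∷ s) |s|≡|g| = step b x
  where
  IH = countᵇ-⊆ᵇ-insertTrue v y s (suc-injective |s|≡|g|)
  D = map (y ∷_) (deletions (s ++ true ∷ []))
  step : ∀ b x → countᵇ (_⊆ᵇ (x ∷ y ∷ s)) (insertTrue (b ∷ v)) ≡
         countᵇ (((b ∷ v) ++ true ∷ []) ⊆ᵇ_) (select (x ∷ (y ∷ s) ++ true ∷ []) (map (x ∷_) (deletions ((y ∷ s) ++ true ∷ []))))
  step b true
    rewrite countᵇ-map (_⊆ᵇ (true ∷ y ∷ s)) (b ∷_) (insertTrue v) | select-map {B = List Bool} (true ∷_) (y ∷ s ++ true ∷ []) D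
          | countᵇ-map (((b ∷ v) ++ true ∷ []) ⊆ᵇ_) (true ∷_) (select (y ∷ s ++ true ∷ []) D) | ⊆ᵇ-∷ʳ-true v s
          | ∨-zeroʳ (not b) = cong₂ _+_ refl IH
  step true false
    rewrite countᵇ-map (_⊆ᵇ (false ∷ y ∷ s)) (true ∷_) (insertTrue v) | select-map {B = List Bool} (false ∷_) (y ∷ s ++ true ∷ []) D
          | countᵇ-map (((true ∷ v) ++ true ∷ []) ⊆ᵇ_) (false ∷_) (select (y ∷ s ++ true ∷ []) D) =
    trans (countᵇ-none _ (insertTrue v) (All.tabulate λ _ → refl))
          (sym (countᵇ-none _ (select (y ∷ s ++ true ∷ []) D) (All.tabulate λ _ → refl)))
  step false false
    rewrite countᵇ-map (_⊆ᵇ (false ∷ y ∷ s)) (false ∷_) (insertTrue v) | select-map {B = List Bool} (false ∷_) (y ∷ s ++ true ∷ []) D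
          | countᵇ-map (((false ∷ v) ++ true ∷ []) ⊆ᵇ_) (false ∷_) (select (y ∷ s ++ true ∷ []) D) = IH

countᵇ-⊆ᵇ-shuffleOne : ∀ g s → length s ≡ suc (length g) →
  countᵇ (_⊆ᵇ s) (shuffleOne g) ≡ countᵇ ((g ++ true ∷ []) ⊆ᵇ_) (select (true ∷ s ++ true ∷ []) (deletions (s ++ true ∷ [])))
countᵇ-⊆ᵇ-shuffleOne g (x ∷ s) |s|≡1+|g| rewrite ⊆ᵇ-∷ʳ-true g s =
  cong₂ _+_ refl (countᵇ-⊆ᵇ-insertTrue g x s (suc-injective |s|≡1+|g|))

length-shuffleOne : ∀ g → All (λ u → length u ≡ suc (length g)) (shuffleOne g)
length-shuffleOne g = refl ∷ length-insertTrue g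
  where
  length-insertTrue : ∀ g → All (λ u → length u ≡ suc (length g)) (insertTrue g)
  length-insertTrue [] = refl ∷ []
  length-insertTrue (b ∷ v) = refl ∷ All.map⁺ (All.map (cong suc) (length-insertTrue v))

L-one⋆L : ∀ γ N e → (L (1 ∷ []) ⋆ L γ) N e ≡ sumℤ (map (Lword γ) (deleteFirsts (wordFrom 1 e)))
L-one⋆L γ N e =
  trans (cong sumℤ (map-cong (λ e₁ → cong (_*ℤ Lword γ (wordFrom 1 (e ∸v e₁))) (L-one N e₁)) (below e)))
        (sumℤ-below-weight₁ e 1 (Lword γ))

L-one⋆L-at-fromBits : ∀ g s → length s ≡ suc (length g) →
  (L (1 ∷ []) ⋆ L (fromBits g)) (length (fromBits s)) (Vec.fromList (fromBits s)) ≡ + countᵇ (_⊆ᵇ s) (shuffleOne g)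
L-one⋆L-at-fromBits g s |s|≡1+|g| = begin
  (L (1 ∷ []) ⋆ L γ) _ e
    ≡⟨ L-one⋆L γ _ e ⟩
  sumℤ (map (Lword γ) (deleteFirsts w))
    ≡⟨ cong sumℤ (map-cong-local (All.map (λ {u} |u|≡ → Lword-ascentMask γ u (fromBits-positive g) (|u|≡Σγ {u} |u|≡)) (length-deleteFirsts w))) ⟩
  sumℤ (map (λ u → + 𝟙 (descentMask γ ⊆ᵇ ascentMask u)) (deleteFirsts w))
    ≡⟨ cong sumℤ (map-∘ {g = λ m → + 𝟙 (descentMask γ ⊆ᵇ m)} {f = ascentMask} (deleteFirsts w)) ⟩
  sumℤ (map (λ m → + 𝟙 (descentMask γ ⊆ᵇ m)) (map ascentMask (deleteFirsts w)))
    ≡⟨ cong (λ M → sumℤ (map (λ m → + 𝟙 (descentMask γ ⊆ᵇ m)) M)) (ascentMask-deleteFirsts w (Linked.tail (wordFrom-linked 1 e))) ⟩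
  sumℤ (map (λ m → + 𝟙 (descentMask γ ⊆ᵇ m)) (select (true ∷ ascentMask w) (deletions (ascentMask w))))
    ≡⟨ sumℤ-𝟙 (descentMask γ ⊆ᵇ_) (select (true ∷ ascentMask w) (deletions (ascentMask w))) ⟩
  + countᵇ (descentMask γ ⊆ᵇ_) (select (true ∷ ascentMask w) (deletions (ascentMask w)))
    ≡⟨ cong₂ (λ d a → + countᵇ (d ⊆ᵇ_) (select (true ∷ a) (deletions a))) (descentMask-fromBits g) (ascentMask-wordFrom-fromBits 1 s) ⟩
  + countᵇ ((g ++ true ∷ []) ⊆ᵇ_) (select (true ∷ s ++ true ∷ []) (deletions (s ++ true ∷ [])))
    ≡⟨ cong +_ (sym (countᵇ-⊆ᵇ-shuffleOne g s |s|≡1+|g|)) ⟩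
  + countᵇ (_⊆ᵇ s) (shuffleOne g) ∎
  where
  open ≡-Reasoning
  γ = fromBits g
  e = Vec.fromList (fromBits s)
  w = wordFrom 1 e
  |u|≡Σγ : ∀ {u} → suc (length u) ≡ length w → length u ≡ sum γ
  |u|≡Σγ {u} |u|≡ = suc-injective (begin
    suc (length u)           ≡⟨ |u|≡ ⟩
    length w                 ≡⟨ length-wordFrom 1 e ⟩
    Vec.sum e                ≡⟨ sum-fromList (fromBits s) ⟩
    sum (fromBits s)         ≡⟨ sum-fromBits s ⟩
    suc (length s)           ≡⟨ cong suc |s|≡1+|g| ⟩
    suc (suc (length g))     ≡⟨ cong suc (sym (sum-fromBits g)) ⟩
    suc (sum γ)              ∎)

L-one⋆L-subsetSum : ∀ g s → length s ≡ suc (length g) →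
  (L (1 ∷ []) ⋆ L (fromBits g)) (length (fromBits s)) (Vec.fromList (fromBits s)) ≡
  subsetSum (suc (length g)) (λ t → + multiplicity t (shuffleOne g)) s
L-one⋆L-subsetSum g s |s|≡1+|g| = begin
  (L (1 ∷ []) ⋆ L (fromBits g)) _ (Vec.fromList (fromBits s))
    ≡⟨ L-one⋆L-at-fromBits g s |s|≡1+|g| ⟩
  + countᵇ (_⊆ᵇ s) (shuffleOne g)
    ≡⟨ sym (sumℤ-𝟙 (_⊆ᵇ s) (shuffleOne g)) ⟩
  sumℤ (map (λ u → + 𝟙 (u ⊆ᵇ s)) (shuffleOne g))
    ≡⟨ sym (sumℤ-multiplicity (suc (length g)) (length-shuffleOne g) (λ t → + 𝟙 (t ⊆ᵇ s))) ⟩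
  subsetSum (suc (length g)) (λ t → + multiplicity t (shuffleOne g)) s ∎
  where open ≡-Reasoning

expansion-subsetSum : ∀ m c F s → length s ≡ m → IsLExpansion (suc m) c F →
  F (length (fromBits s)) (Vec.fromList (fromBits s)) ≡ subsetSum m (c ∘ fromBits) s
expansion-subsetSum m c F s |s|≡m expansion = begin
  F _ e
    ≡⟨ expansion _ e ⟩
  sumℤ (map (λ β → c β *ℤ L β _ e) (comps (suc m)))
    ≡⟨ cong (λ βs → sumℤ (map (λ β → c β *ℤ L β _ e) βs)) (comps-bitStrings m) ⟩
  sumℤ (map (λ β → c β *ℤ L β _ e) (map fromBits (bitStrings m)))
    ≡⟨ cong sumℤ (sym (map-∘ (bitStrings m))) ⟩
  sumℤ (map (λ t → c (fromBits t) *ℤ L (fromBits t) _ e) (bitStrings m))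
    ≡⟨ cong sumℤ (map-cong-local (All.map (λ {t} |t|≡m → cong (c (fromBits t) *ℤ_) (L-fromBits-at-fromBits t s (trans |t|≡m (sym |s|≡m))))
                                           (length-bitStrings m))) ⟩
  subsetSum m (c ∘ fromBits) s ∎
  where
  open ≡-Reasoning
  e = Vec.fromList (fromBits s)

L-one⋆L-coefficient : ∀ g c → IsLExpansion (suc (suc (length g))) c (L (1 ∷ []) ⋆ L (fromBits g)) →
  ∀ x → length x ≡ suc (length g) → c (fromBits x) ≡ + multiplicity x (shuffleOne g)
L-one⋆L-coefficient g c expansion = subsetSum-injective (suc (length g)) λ s |s|≡1+|g| →
  trans (sym (expansion-subsetSum _ c _ s |s|≡1+|g| expansion)) (L-one⋆L-subsetSum g s |s|≡1+|g|)

corollary7p13 : (n : ℕ) → 1 < n → (α : List ℕ) → IsComposition n α →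
    (γ : List ℕ) → IsComposition (n ∸ 1) γ →
    (c : List ℕ → ℤ) → IsLExpansion n c (L (1 ∷ []) ⋆ L γ) →
    c α ≡ ribbonCoeff (rhs α) γ
corollary7p13 (suc (suc m)) (s≤s (s≤s z≤n)) α α-comp γ γ-comp c expansion = begin
  c α                                           ≡⟨ cong c (sym α≡) ⟩
  c (fromBits x)                                ≡⟨ L-one⋆L-coefficient g c expansion′ x |x|≡1+|g| ⟩
  + multiplicity x (shuffleOne g)               ≡⟨ sym (ribbonCoeff-rhs-fromBits g x |x|≡1+|g|) ⟩
  ribbonCoeff (rhs (fromBits x)) (fromBits g)   ≡⟨ cong₂ (λ α′ γ′ → ribbonCoeff (rhs α′) γ′) α≡ γ≡ ⟩
  ribbonCoeff (rhs α) γ                         ∎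
  where
  open ≡-Reasoning
  x = toBits α
  g = toBits γ
  α≡ = fromBits-toBits-composition α α-comp
  γ≡ = fromBits-toBits-composition γ γ-comp
  |g|≡m = length-toBits γ γ-comp
  |x|≡1+|g| : length x ≡ suc (length g)
  |x|≡1+|g| = trans (length-toBits α α-comp) (cong suc (sym |g|≡m))
  expansion′ : IsLExpansion (suc (suc (length g))) c (L (1 ∷ []) ⋆ L (fromBits g))
  expansion′ = subst₂ (λ k δ → IsLExpansion (suc (suc k)) c (L (1 ∷ []) ⋆ L δ)) (sym |g|≡m) (sym γ≡) expansion
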